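{- Let $A=\{a_1,a_2,\ldots,a_r\}\subset\mathbb{N}$ with $1<a_1<a_2<\cdots<a_r$ and the $a_i$ pairwise coprime. Then $$\rho(A)=\frac12\left(1+\prod_{i=1}^r\frac{a_i-1}{a_i+1}\right).$$
   Context: A set $S$ of positive integers is $A$-quotient-free if there are no $x,y\in S$ with $x/y\in A$. For $X>0$ let $[X]=\{k\in\mathbb{N}:k\le X\}$. A set $S\subseteq\mathbb{N}$ has asymptotic density $\delta(S)$ if $\lim_{X\to\infty}|S\cap[X]|/X$ exists, and $\delta(S)$ is this limit. $\rho(A)$ is the supremum of $\delta(S)$ over all $A$-quotient-free sets $S$ for which $\delta(S)$ exists. -}

module Defs where

open import Data.Bool using (Bool; true; false; if_then_else_)
open import Data.Nat as ℕ using (ℕ; zero; suc)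
open import Data.Integer using (+_)
open import Data.Rational as ℚ using (ℚ; 1ℚ; ½)
open import Data.List using (List; []; _∷_)
open import Data.List.Membership.Propositional using (_∈_)
open import Data.Product using (∃; _×_)
open import Relation.Binary.PropositionalEquality using (_≡_; _≢_)

-- A subset S of ℕ is given by its characteristic function.
-- count S X = |S ∩ [X]| = #{ k : 1 ≤ k ≤ X , S k ≡ true }
count : (ℕ → Bool) → ℕ → ℕ
count S zero = 0
count S (suc X) = (if S (suc X) then 1 else 0) ℕ.+ count S X

ratio : (ℕ → Bool) → ℕ → ℚ
ratio S n = (+ count S (suc n)) ℚ./ suc n

-- S is a set of positive integers
PositiveSet : (ℕ → Bool) → Set
PositiveSet S = S 0 ≡ false

-- no x, y ∈ S with x / y ∈ A, i.e. x = a * y for some a ∈ A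
QuotientFree : List ℕ → (ℕ → Bool) → Set
QuotientFree A S = ∀ x y → S x ≡ true → S y ≡ true → ∀ a → a ∈ A → x ≢ a ℕ.* y

-- asymptotic density exists: the sequence |S ∩ [X]| / X is Cauchy
-- (equivalently, convergent in ℝ)
HasDensity : (ℕ → Bool) → Set
HasDensity S = ∀ ε → ℚ.Positive ε → ∃ λ N → ∀ m n → N ℕ.≤ m → N ℕ.≤ n →
  ℚ.∣ ratio S m ℚ.- ratio S n ∣ ℚ.< ε

prodTerm : List ℕ → ℚ
prodTerm [] = 1ℚ
prodTerm (a ∷ as) = ((+ (a ℕ.∸ 1)) ℚ./ suc a) ℚ.* prodTerm as

rhoFormula : List ℕ → ℚ
rhoFormula A = ½ ℚ.* (1ℚ ℚ.+ prodTerm A)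

module Submission where

-- Call d an admissible divisor of n if d ∣ n and d is the product of a
-- subset of A.  Put N(n) = #{admissible d : n/d ∈ S}, D(n) = #{admissible d} and
-- E(n) = [no aᵢ divides n].  Pairing d with d·aᵢ shows that quotient-freeness forces
-- 2·N(n) ≤ D(n) + E(n) for every n.  Summed over n ≤ k·∏aᵢ the three sides become
-- Σ_{T ⊆ A} |S ∩ [k·∏_{T} aᵢ]|,  k·∏(aᵢ+1)  and  k·∏(aᵢ-1);  so if |S ∩ [j]| ≥ L·j for
-- all large j, then 2L·k·∏(aᵢ+1) ≤ k·(∏(aᵢ+1) + ∏(aᵢ-1)), i.e. L ≤ ρ(A).
--
-- For even K let S_K be the set of n all of whose aᵢ-adic valuations are
-- < K and whose valuations have even sum.  Multiplying by some aᵢ changes the parity or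
-- overflows a valuation, so S_K is quotient-free.  S_K is periodic modulo M = ∏ aᵢ^K, so
-- it has a density, and counting one period gives density ρ(A)·∏(1 - aᵢ^{-K}), which is
-- at least ρ(A) - r/2^K.

open import Defs
open import Data.Bool using (Bool)
open import Data.Nat as ℕ using (ℕ; suc; _*_; _≤_; _<_)
open import Data.Nat.Coprimality using (Coprime)
import Data.Rational as ℚ
open import Data.List using (List)
open import Data.List.Relation.Unary.All using (All)
open import Data.List.Relation.Unary.AllPairs using (AllPairs)
open import Data.Product using (∃; _×_; _,_)
open import Relation.Binary.PropositionalEquality using (_≡_)

-- The embedding n ↦ n/1 of ℕ into ℚ and its compatibility with the operations; all
-- rational estimates below are obtained by transporting inequalities between naturals.
module Embedding where

  open import Data.Nat as ℕ using (ℕ; suc)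
  open import Data.Integer as ℤ using (+_)
  open import Data.Rational as ℚ using (ℚ; mkℚ; _/_; toℚᵘ; 1ℚ)
  open import Data.Product using (∃; _,_)
  import Data.Rational.Properties as ℚP
  open import Data.Rational.Unnormalised as U using (mkℚᵘ; *≡*)
  import Data.Rational.Unnormalised.Properties as UP
  import Data.Integer.Properties as ℤP
  open import Relation.Binary.PropositionalEquality

  ⟦_⟧ : ℕ → ℚ
  ⟦ n ⟧ = + n / 1

  toℚᵘ-/ : ∀ i k → toℚᵘ (i / suc k) U.≃ mkℚᵘ i k
  toℚᵘ-/ i k = ℚP.toℚᵘ-fromℚᵘ (mkℚᵘ i k)

  ⟦⟧-+ : ∀ m n → ⟦ m ℕ.+ n ⟧ ≡ ⟦ m ⟧ ℚ.+ ⟦ n ⟧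
  ⟦⟧-+ m n = ℚP.toℚᵘ-injective (UP.≃-trans (toℚᵘ-/ (+ (m ℕ.+ n)) 0) (UP.≃-trans (*≡* eq)
     (UP.≃-sym (UP.≃-trans (ℚP.toℚᵘ-homo-+ ⟦ m ⟧ ⟦ n ⟧) (UP.+-cong (toℚᵘ-/ (+ m) 0) (toℚᵘ-/ (+ n) 0))))))
    where
    eq : + (m ℕ.+ n) ℤ.* (+ 1 ℤ.* + 1) ≡ (+ m ℤ.* + 1 ℤ.+ + n ℤ.* + 1) ℤ.* + 1
    eq = begin
      + (m ℕ.+ n) ℤ.* (+ 1 ℤ.* + 1)  ≡⟨ ℤP.*-identityʳ (+ (m ℕ.+ n)) ⟩
      + m ℤ.+ + n                     ≡⟨ cong₂ ℤ._+_ (sym (ℤP.*-identityʳ (+ m))) (sym (ℤP.*-identityʳ (+ n))) ⟩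
      + m ℤ.* + 1 ℤ.+ + n ℤ.* + 1     ≡⟨ sym (ℤP.*-identityʳ (+ m ℤ.* + 1 ℤ.+ + n ℤ.* + 1)) ⟩
      (+ m ℤ.* + 1 ℤ.+ + n ℤ.* + 1) ℤ.* + 1 ∎
      where open ≡-Reasoning

  ⟦⟧-* : ∀ m n → ⟦ m ℕ.* n ⟧ ≡ ⟦ m ⟧ ℚ.* ⟦ n ⟧
  ⟦⟧-* m n = ℚP.toℚᵘ-injective (UP.≃-trans (toℚᵘ-/ (+ (m ℕ.* n)) 0) (UP.≃-trans (*≡* eq)
     (UP.≃-sym (UP.≃-trans (ℚP.toℚᵘ-homo-* ⟦ m ⟧ ⟦ n ⟧) (UP.*-cong (toℚᵘ-/ (+ m) 0) (toℚᵘ-/ (+ n) 0))))))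
    where
    eq : + (m ℕ.* n) ℤ.* (+ 1 ℤ.* + 1) ≡ (+ m ℤ.* + n) ℤ.* + 1
    eq = trans (ℤP.*-identityʳ (+ (m ℕ.* n))) (trans (ℤP.pos-* m n) (sym (ℤP.*-identityʳ (+ m ℤ.* + n))))

  /-*-cancel : ∀ i k → (i / suc k) ℚ.* ⟦ suc k ⟧ ≡ i / 1
  /-*-cancel i k = ℚP.toℚᵘ-injective (UP.≃-trans (ℚP.toℚᵘ-homo-* (i / suc k) ⟦ suc k ⟧)
     (UP.≃-trans (UP.*-cong (toℚᵘ-/ i k) (toℚᵘ-/ (+ suc k) 0)) (UP.≃-trans (*≡* eq) (UP.≃-sym (toℚᵘ-/ i 0)))))
    where
    eq : (i ℤ.* + suc k) ℤ.* + 1 ≡ i ℤ.* (+ suc k ℤ.* + 1)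
    eq = ℤP.*-assoc i (+ suc k) (+ 1)

  ⟦⟧-mono-≤ : ∀ {m n} → m ℕ.≤ n → ⟦ m ⟧ ℚ.≤ ⟦ n ⟧
  ⟦⟧-mono-≤ {m} {n} m≤n = ℚP.toℚᵘ-cancel-≤ (UP.≤-respʳ-≃ (UP.≃-sym (toℚᵘ-/ (+ n) 0))
     (UP.≤-respˡ-≃ (UP.≃-sym (toℚᵘ-/ (+ m) 0)) (U.*≤* (ℤP.*-monoʳ-≤-nonNeg (+ 1) (ℤ.+≤+ m≤n)))))

  ⟦⟧-mono-< : ∀ {m n} → m ℕ.< n → ⟦ m ⟧ ℚ.< ⟦ n ⟧
  ⟦⟧-mono-< {m} {n} m<n = ℚP.toℚᵘ-cancel-< (UP.<-respʳ-≃ (UP.≃-sym (toℚᵘ-/ (+ n) 0))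
     (UP.<-respˡ-≃ (UP.≃-sym (toℚᵘ-/ (+ m) 0)) (U.*<* (ℤP.*-monoʳ-<-pos (+ 1) (ℤ.+<+ m<n)))))

  ⟦⟧-nonNeg : ∀ n → ℚ.NonNegative ⟦ n ⟧
  ⟦⟧-nonNeg n = ℚ.nonNegative (⟦⟧-mono-≤ {0} {n} ℕ.z≤n)

  ⟦⟧-pos : ∀ {n} → 0 ℕ.< n → ℚ.Positive ⟦ n ⟧
  ⟦⟧-pos 0<n = ℚ.positive (⟦⟧-mono-< 0<n)

  archimedean : ∀ ε → ℚ.Positive ε → ∃ λ m → 1ℚ ℚ.≤ ⟦ suc m ⟧ ℚ.* ε
  archimedean ε@(mkℚ ℤ.+[1+ p ] d _) _ = d , ℚP.≤-trans (⟦⟧-mono-≤ {1} {suc p} (ℕ.s≤s ℕ.z≤n)) (ℚP.≤-reflexive (sym e))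
    where
    e : ⟦ suc d ⟧ ℚ.* ε ≡ ⟦ suc p ⟧
    e = trans (ℚP.*-comm ⟦ suc d ⟧ ε) (trans (cong (ℚ._* ⟦ suc d ⟧) (sym (ℚP.↥p/↧p≡p ε))) (/-*-cancel (+ suc p) d))

module Sums where

  open import Data.Nat as ℕ using (ℕ; zero; suc; _+_; _*_; _≤_; _<_; z≤n; s≤s)
  open import Data.Nat.Properties
  open import Data.Nat.Divisibility using (_∣_; _∣?_; quotient; divides; ∣m+n∣m⇒∣n; m∣m*n; ∣⇒≤)
  open import Data.Nat.Coprimality using (Coprime; coprime-divisor)
  import Data.Nat.Coprimality as Coprimality
  open import Relation.Nullary using (Dec; yes; no; ¬_; contradiction)
  open import Relation.Binary.PropositionalEquality
  open import Data.Nat.Solver using (module +-*-Solver)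
  open +-*-Solver

  sumTo : (ℕ → ℕ) → ℕ → ℕ
  sumTo F zero = 0
  sumTo F (suc X) = F (suc X) + sumTo F X

  sumTo-cong : ∀ {F G} → (∀ n → F n ≡ G n) → ∀ X → sumTo F X ≡ sumTo G X
  sumTo-cong F≡G zero = refl
  sumTo-cong F≡G (suc X) = cong₂ _+_ (F≡G (suc X)) (sumTo-cong F≡G X)

  sumTo-+ : ∀ F G X → sumTo (λ n → F n + G n) X ≡ sumTo F X + sumTo G X
  sumTo-+ F G zero = refl
  sumTo-+ F G (suc X) = begin
    (F (suc X) + G (suc X)) + sumTo (λ n → F n + G n) X ≡⟨ cong ((F (suc X) + G (suc X)) +_) (sumTo-+ F G X) ⟩
    (F (suc X) + G (suc X)) + (sumTo F X + sumTo G X)   ≡⟨ interchange (F (suc X)) (G (suc X)) (sumTo F X) (sumTo G X) ⟩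
    (F (suc X) + sumTo F X) + (G (suc X) + sumTo G X)   ∎
    where
    open ≡-Reasoning
    interchange : ∀ a b c d → (a + b) + (c + d) ≡ (a + c) + (b + d)
    interchange = solve 4 (λ a b c d → (a :+ b) :+ (c :+ d) := (a :+ c) :+ (b :+ d)) refl

  sumTo-mono : ∀ {F G} → (∀ n → F n ≤ G n) → ∀ X → sumTo F X ≤ sumTo G X
  sumTo-mono F≤G zero = z≤n
  sumTo-mono F≤G (suc X) = +-mono-≤ (F≤G (suc X)) (sumTo-mono F≤G X)

  sumTo-* : ∀ c F X → sumTo (λ n → c * F n) X ≡ c * sumTo F X
  sumTo-* c F zero = sym (*-zeroʳ c)
  sumTo-* c F (suc X) = trans (cong (c * F (suc X) +_) (sumTo-* c F X)) (sym (*-distribˡ-+ c (F (suc X)) (sumTo F X)))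

  sumTo-1 : ∀ X → sumTo (λ _ → 1) X ≡ X
  sumTo-1 zero = refl
  sumTo-1 (suc X) = cong suc (sumTo-1 X)

  sumTo-0 : ∀ X → sumTo (λ _ → 0) X ≡ 0
  sumTo-0 zero = refl
  sumTo-0 (suc X) = sumTo-0 X

  -- onMultiples a F n = F (n / a) if a ∣ n, and 0 otherwise.  The definition goes
  -- through the decision a ∣? n so that proofs can case on it.
  onMultiplesᵈ : ∀ {a n} → (ℕ → ℕ) → Dec (a ∣ n) → ℕ
  onMultiplesᵈ F (yes a∣n) = F (quotient a∣n)
  onMultiplesᵈ F (no _) = 0

  onMultiples : ℕ → (ℕ → ℕ) → ℕ → ℕ
  onMultiples a F n = onMultiplesᵈ F (a ∣? n)

  onMultiples-mul : ∀ a F n q → n ≡ q * suc a → onMultiples (suc a) F n ≡ F q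
  onMultiples-mul a F n q n≡qa with suc a ∣? n
  ... | yes (divides q′ n≡q′a) = cong F (*-cancelʳ-≡ q′ q (suc a) (trans (sym n≡q′a) n≡qa))
  ... | no a∤n = contradiction (divides q n≡qa) a∤n

  onMultiples-non : ∀ a F n → ¬ (a ∣ n) → onMultiples a F n ≡ 0
  onMultiples-non a F n a∤n with a ∣? n
  ... | yes a∣n = contradiction a∣n a∤n
  ... | no _ = refl

  -- Between consecutive multiples a·Y and a·(Y+1) only the last term contributes.
  sumTo-onMultiples : ∀ a F Y → sumTo (onMultiples (suc a) F) (suc a * Y) ≡ sumTo F Y
  sumTo-onMultiples a F zero = cong (sumTo G) (*-zeroʳ (suc a))
    where G = onMultiples (suc a) F
  sumTo-onMultiples a F (suc Y) = begin
    sumTo G (suc a * suc Y)                          ≡⟨ cong (sumTo G) (*-suc (suc a) Y) ⟩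
    G (suc (a + suc a * Y)) + sumTo G (a + suc a * Y) ≡⟨ cong₂ _+_ last (skip a ≤-refl) ⟩
    F (suc Y) + sumTo G (suc a * Y)                  ≡⟨ cong (F (suc Y) +_) (sumTo-onMultiples a F Y) ⟩
    F (suc Y) + sumTo F Y                            ∎
    where
    open ≡-Reasoning
    G = onMultiples (suc a) F
    last : G (suc (a + suc a * Y)) ≡ F (suc Y)
    last = onMultiples-mul a F _ (suc Y) (trans (sym (*-suc (suc a) Y)) (*-comm (suc a) (suc Y)))
    -- the numbers a·Y + j with 0 < j ≤ a are not multiples of a + 1
    skip : ∀ i → i ≤ a → sumTo G (i + suc a * Y) ≡ sumTo G (suc a * Y)
    skip zero _ = refl
    skip (suc i) i<a = cong₂ _+_ (onMultiples-non (suc a) F _ not-multiple) (skip i (<⇒≤ i<a))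
      where
      not-multiple : ¬ (suc a ∣ suc i + suc a * Y)
      not-multiple d = <⇒≱ (s≤s i<a) (∣⇒≤ (∣m+n∣m⇒∣n (subst (suc a ∣_) (+-comm (suc i) (suc a * Y)) d) (m∣m*n Y)))

  -- Summing F plus G placed on the multiples of a + 1, over k·((a + 1)·P): the shape of
  -- every recursion step along the list A below.
  sumTo-withMultiples : ∀ a F G k P → sumTo (λ n → F n + onMultiples (suc a) G n) (k * (suc a * P))
                        ≡ sumTo F (k * (suc a * P)) + sumTo G (k * P)
  sumTo-withMultiples a F G k P = begin
    sumTo (λ n → F n + onMultiples (suc a) G n) (k * (suc a * P))  ≡⟨ sumTo-+ F (onMultiples (suc a) G) (k * (suc a * P)) ⟩
    sumTo F (k * (suc a * P)) + sumTo (onMultiples (suc a) G) (k * (suc a * P))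
      ≡⟨ cong (λ X → sumTo F (k * (suc a * P)) + sumTo (onMultiples (suc a) G) X) (reorder k (suc a) P) ⟩
    sumTo F (k * (suc a * P)) + sumTo (onMultiples (suc a) G) (suc a * (k * P))
      ≡⟨ cong (sumTo F (k * (suc a * P)) +_) (sumTo-onMultiples a G (k * P)) ⟩
    sumTo F (k * (suc a * P)) + sumTo G (k * P)                      ∎
    where
    open ≡-Reasoning
    reorder : ∀ k a P → k * (a * P) ≡ a * (k * P)
    reorder = solve 3 (λ k a P → k :* (a :* P) := a :* (k :* P)) refl

  coprime-∤-* : ∀ {a b} m → Coprime a b → ¬ (b ∣ m) → ¬ (b ∣ m * a)
  coprime-∤-* {a} {b} m a⊥b b∤m b∣ma = b∤m (coprime-divisor (Coprimality.sym a⊥b) (subst (b ∣_) (*-comm m a) b∣ma))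

module Products where

  open import Data.Nat as ℕ using (ℕ; suc; _*_; _∸_; _≤_; _<_; z≤n; s≤s)
  open import Data.Nat.Properties using (*-mono-<; *-mono-≤; ≤-refl; ≤-trans; <-trans; m∸n≤m; n≤1+n)
  open import Data.List using (List; []; _∷_)
  open import Data.List.Relation.Unary.All as All using (All)

  Positive : List ℕ → Set
  Positive = All (0 <_)

  >1⇒Positive : ∀ {A} → All (1 <_) A → Positive A
  >1⇒Positive = All.map (λ 1<a → <-trans (s≤s z≤n) 1<a)

  ∏ ∏⁺ ∏⁻ : List ℕ → ℕ
  ∏ [] = 1
  ∏ (a ∷ A) = a * ∏ A
  ∏⁺ [] = 1
  ∏⁺ (a ∷ A) = suc a * ∏⁺ A
  ∏⁻ [] = 1
  ∏⁻ (a ∷ A) = (a ∸ 1) * ∏⁻ A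

  ∏⁺-pos : ∀ A → 0 < ∏⁺ A
  ∏⁺-pos [] = s≤s z≤n
  ∏⁺-pos (a ∷ A) = *-mono-< {0} {suc a} {0} {∏⁺ A} (s≤s z≤n) (∏⁺-pos A)

  ∏⁻≤∏⁺ : ∀ A → ∏⁻ A ≤ ∏⁺ A
  ∏⁻≤∏⁺ [] = ≤-refl
  ∏⁻≤∏⁺ (a ∷ A) = *-mono-≤ (≤-trans (m∸n≤m a 1) (n≤1+n a)) (∏⁻≤∏⁺ A)

-- For a list A, divisorCount A n counts the subsets T ⊆ A with
-- ∏_T ∣ n, and avoids A n is 1 if no element of A divides n and 0 otherwise.
module AdmissibleDivisors where

  open import Data.Nat as ℕ using (ℕ; suc; _+_; _*_; _≤_; z≤n; s≤s)
  open import Data.Nat.Properties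
  open import Data.Nat.Divisibility using (_∣_; _∣?_; divides; ∣m⇒∣m*n)
  open import Data.Nat.Coprimality using (Coprime)
  open import Data.List using (List; []; _∷_)
  open import Data.List.Relation.Unary.All using (All; []; _∷_)
  open import Data.List.Relation.Unary.AllPairs using (AllPairs; []; _∷_)
  open import Relation.Nullary using (Dec; yes; no)
  open import Relation.Binary.PropositionalEquality
  open import Data.Empty using (⊥-elim)
  open import Data.Nat.Solver using (module +-*-Solver)
  open +-*-Solver
  open Sums
  open Products

  divisorCount : List ℕ → ℕ → ℕ
  divisorCount [] n = 1
  divisorCount (a ∷ A) n = divisorCount A n + onMultiples a (divisorCount A) n

  avoidsᵈ : ∀ {a n} → ℕ → Dec (a ∣ n) → ℕ
  avoidsᵈ v (yes _) = 0
  avoidsᵈ v (no _) = v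

  avoids : List ℕ → ℕ → ℕ
  avoids [] n = 1
  avoids (a ∷ A) n = avoidsᵈ (avoids A n) (a ∣? n)

  -- Every admissible divisor of m is one of m·c.
  divisorCount-mono : ∀ A → Positive A → ∀ m c → divisorCount A m ≤ divisorCount A (m * c)
  divisorCount-mono [] _ m c = ≤-refl
  divisorCount-mono (suc b ∷ A) (s≤s z≤n ∷ ps) m c = +-mono-≤ (divisorCount-mono A ps m c) onMultiples-≤
    where
    onMultiples-≤ : onMultiples (suc b) (divisorCount A) m ≤ onMultiples (suc b) (divisorCount A) (m * c)
    onMultiples-≤ with suc b ∣? m
    ... | no _ = z≤n
    ... | yes (divides q m≡qb) = ≤-trans (divisorCount-mono A ps q c)
            (≤-reflexive (sym (onMultiples-mul b (divisorCount A) (m * c) (q * c)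
               (trans (cong (_* c) m≡qb) (solve 3 (λ q b c → q :* b :* c := q :* c :* b) refl q (suc b) c)))))

  sumTo-divisorCount : ∀ A → Positive A → ∀ k → sumTo (divisorCount A) (k * ∏ A) ≡ k * ∏⁺ A
  sumTo-divisorCount [] _ k = sumTo-1 (k * 1)
  sumTo-divisorCount (suc a ∷ A) (s≤s z≤n ∷ ps) k = begin
    sumTo (divisorCount (suc a ∷ A)) (k * (suc a * ∏ A))
      ≡⟨ sumTo-withMultiples a (divisorCount A) (divisorCount A) k (∏ A) ⟩
    sumTo (divisorCount A) (k * (suc a * ∏ A)) + sumTo (divisorCount A) (k * ∏ A)
      ≡⟨ cong (λ X → sumTo (divisorCount A) X + sumTo (divisorCount A) (k * ∏ A)) (*-assoc k (suc a) (∏ A)) ⟨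
    sumTo (divisorCount A) (k * suc a * ∏ A) + sumTo (divisorCount A) (k * ∏ A)
      ≡⟨ cong₂ _+_ (sumTo-divisorCount A ps (k * suc a)) (sumTo-divisorCount A ps k) ⟩
    k * suc a * ∏⁺ A + k * ∏⁺ A                               ≡⟨ solve 3 (λ k a P → k :* a :* P :+ k :* P := k :* ((con 1 :+ a) :* P)) refl k (suc a) (∏⁺ A) ⟩
    k * ∏⁺ (suc a ∷ A)                                         ∎
    where open ≡-Reasoning

  avoids-coprime : ∀ a A → All (Coprime a) A → ∀ q → avoids A (q * a) ≡ avoids A q
  avoids-coprime a [] _ q = refl
  avoids-coprime a (b ∷ A) (a⊥b ∷ cs) q = cases (b ∣? (q * a)) (b ∣? q)
    where
    cases : (d : Dec (b ∣ q * a)) (d′ : Dec (b ∣ q)) → avoidsᵈ (avoids A (q * a)) d ≡ avoidsᵈ (avoids A q) d′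
    cases (yes _) (yes _) = refl
    cases (no _) (no _) = avoids-coprime a A cs q
    cases (yes b∣qa) (no b∤q) = ⊥-elim (coprime-∤-* q a⊥b b∤q b∣qa)
    cases (no b∤qa) (yes b∣q) = ⊥-elim (b∤qa (∣m⇒∣m*n a b∣q))

  avoids-split : ∀ a A → All (Coprime (suc a)) A → ∀ n →
                 avoids A n ≡ avoids (suc a ∷ A) n + onMultiples (suc a) (avoids A) n
  avoids-split a A cs n = cases (suc a ∣? n)
    where
    cases : (d : Dec (suc a ∣ n)) → avoids A n ≡ avoidsᵈ (avoids A n) d + onMultiples (suc a) (avoids A) n
    cases (yes (divides q n≡qa)) = trans (cong (avoids A) n≡qa)
      (trans (avoids-coprime (suc a) A cs q) (sym (onMultiples-mul a (avoids A) n q n≡qa)))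
    cases (no a∤n) = sym (trans (cong (avoids A n +_) (onMultiples-non (suc a) (avoids A) n a∤n)) (+-identityʳ _))

  sumTo-avoids : ∀ A → Positive A → AllPairs Coprime A → ∀ k → sumTo (avoids A) (k * ∏ A) ≡ k * ∏⁻ A
  sumTo-avoids [] _ _ k = sumTo-1 (k * 1)
  sumTo-avoids (suc a ∷ A) (s≤s z≤n ∷ ps) (cs ∷ cps) k = +-cancelʳ-≡ (k * ∏⁻ A) _ _ (begin
    sumTo (avoids (suc a ∷ A)) (k * (suc a * ∏ A)) + k * ∏⁻ A
      ≡⟨ cong (sumTo (avoids (suc a ∷ A)) (k * (suc a * ∏ A)) +_) (sym (sumTo-avoids A ps cps k)) ⟩
    sumTo (avoids (suc a ∷ A)) (k * (suc a * ∏ A)) + sumTo (avoids A) (k * ∏ A)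
      ≡⟨ sumTo-withMultiples a (avoids (suc a ∷ A)) (avoids A) k (∏ A) ⟨
    sumTo (λ n → avoids (suc a ∷ A) n + onMultiples (suc a) (avoids A) n) (k * (suc a * ∏ A))
      ≡⟨ sumTo-cong (avoids-split a A cs) (k * (suc a * ∏ A)) ⟨
    sumTo (avoids A) (k * (suc a * ∏ A))                     ≡⟨ cong (sumTo (avoids A)) (*-assoc k (suc a) (∏ A)) ⟨
    sumTo (avoids A) (k * suc a * ∏ A)                       ≡⟨ sumTo-avoids A ps cps (k * suc a) ⟩
    k * suc a * ∏⁻ A                                          ≡⟨ solve 3 (λ k a P → k :* (con 1 :+ a) :* P := k :* (a :* P) :+ k :* P) refl k a (∏⁻ A) ⟩
    k * ∏⁻ (suc a ∷ A) + k * ∏⁻ A                             ∎)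
    where open ≡-Reasoning

-- The counting argument for the upper bound, for a fixed S ⊆ ℕ.  hits A n counts the
-- subsets T ⊆ A with ∏_T ∣ n and n / ∏_T ∈ S; quotient-freeness forces
-- 2·hits ≤ divisorCount + avoids pointwise, and summing gives the bound on
-- segmentCounts A k = Σ_{T ⊆ A} |S ∩ [k·∏_T]|.
module UpperCount (S : ℕ → Bool) where

  open import Data.Bool using (Bool; true; false; if_then_else_)
  open import Data.Nat as ℕ using (ℕ; zero; suc; _+_; _*_; _≤_; z≤n; s≤s)
  open import Data.Nat.Properties
  open import Data.Nat.Divisibility using (_∣_; _∣?_; divides)
  open import Data.Nat.Coprimality using (Coprime)
  open import Data.List using (List; []; _∷_)
  open import Data.List.Relation.Unary.All using (All; []; _∷_)
  open import Data.List.Relation.Unary.AllPairs using (AllPairs; []; _∷_)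
  open import Relation.Nullary using (Dec; yes; no)
  open import Relation.Binary.PropositionalEquality
  open import Data.Empty using (⊥; ⊥-elim)
  open import Data.Nat.Solver using (module +-*-Solver)
  open +-*-Solver
  open import Defs using (count)
  open Sums
  open Products
  open AdmissibleDivisors

  indicator : ℕ → ℕ
  indicator n = if S n then 1 else 0

  sumTo-indicator : ∀ X → sumTo indicator X ≡ count S X
  sumTo-indicator zero = refl
  sumTo-indicator (suc X) = cong (indicator (suc X) +_) (sumTo-indicator X)

  hits : List ℕ → ℕ → ℕ
  hits [] = indicator
  hits (a ∷ A) n = hits A n + onMultiples a (hits A) n

  FreeOfRatio : ℕ → Set
  FreeOfRatio a = ∀ m → S (m * a) ≡ true → S m ≡ true → ⊥

  -- For a coprime to A, the admissible divisors of m·a are those of m, and each of them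
  -- hits at most one of m·a and m.
  hits-pair : ∀ a A → Positive A → All (Coprime a) A → FreeOfRatio a →
              ∀ m → hits A (m * a) + hits A m ≤ divisorCount A m
  hits-pair a [] _ _ free m with S (m * a) in Sma | S m in Sm
  ... | true  | true  = ⊥-elim (free m Sma Sm)
  ... | true  | false = ≤-refl
  ... | false | true  = s≤s z≤n
  ... | false | false = z≤n
  hits-pair a (suc b ∷ A) (s≤s z≤n ∷ ps) (a⊥b ∷ cs) free m = cases (suc b ∣? m)
    where
    open ≤-Reasoning
    H = hits A
    onB : (ℕ → ℕ) → ℕ → ℕ
    onB = onMultiples (suc b)
    ih : ∀ m → H (m * a) + H m ≤ divisorCount A m
    ih = hits-pair a A ps cs free
    cases : Dec (suc b ∣ m) → (H (m * a) + onB H (m * a)) + (H m + onB H m) ≤ divisorCount A m + onB (divisorCount A) m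
    cases (yes (divides q m≡qb)) = begin
      (H (m * a) + onB H (m * a)) + (H m + onB H m)
        ≡⟨ cong₂ (λ x y → (H (m * a) + x) + (H m + y)) (onMultiples-mul b H (m * a) (q * a) ma≡qab) (onMultiples-mul b H m q m≡qb) ⟩
      (H (m * a) + H (q * a)) + (H m + H q)    ≡⟨ solve 4 (λ w x y z → (w :+ x) :+ (y :+ z) := (w :+ y) :+ (x :+ z)) refl (H (m * a)) (H (q * a)) (H m) (H q) ⟩
      (H (m * a) + H m) + (H (q * a) + H q)    ≤⟨ +-mono-≤ (ih m) (ih q) ⟩
      divisorCount A m + divisorCount A q      ≡⟨ cong (divisorCount A m +_) (onMultiples-mul b (divisorCount A) m q m≡qb) ⟨
      divisorCount A m + onB (divisorCount A) m ∎
      where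
      ma≡qab : m * a ≡ q * a * suc b
      ma≡qab = trans (cong (_* a) m≡qb) (solve 3 (λ q b a → q :* b :* a := q :* a :* b) refl q (suc b) a)
    cases (no b∤m) = begin
      (H (m * a) + onB H (m * a)) + (H m + onB H m)
        ≡⟨ cong₂ (λ x y → (H (m * a) + x) + (H m + y)) (onMultiples-non (suc b) H (m * a) (coprime-∤-* m a⊥b b∤m)) (onMultiples-non (suc b) H m b∤m) ⟩
      (H (m * a) + 0) + (H m + 0)              ≡⟨ cong₂ _+_ (+-identityʳ (H (m * a))) (+-identityʳ (H m)) ⟩
      H (m * a) + H m                          ≤⟨ ih m ⟩
      divisorCount A m                         ≡⟨ +-identityʳ (divisorCount A m) ⟨
      divisorCount A m + 0                     ≡⟨ cong (divisorCount A m +_) (onMultiples-non (suc b) (divisorCount A) m b∤m) ⟨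
      divisorCount A m + onB (divisorCount A) m ∎

  hits-bound : ∀ A → Positive A → AllPairs Coprime A → All FreeOfRatio A →
               ∀ n → 2 * hits A n ≤ divisorCount A n + avoids A n
  hits-bound [] _ _ _ n with S n
  ... | true = ≤-refl
  ... | false = z≤n
  hits-bound (suc a ∷ A) (s≤s z≤n ∷ ps) (cs ∷ cps) (free ∷ frees) n = cases (suc a ∣? n)
    where
    open ≤-Reasoning
    H = hits A
    D = divisorCount A
    onA : (ℕ → ℕ) → ℕ → ℕ
    onA = onMultiples (suc a)
    cases : (d : Dec (suc a ∣ n)) → 2 * (H n + onA H n) ≤ D n + onA D n + avoidsᵈ (avoids A n) d
    cases (yes (divides q n≡qa)) = begin
      2 * (H n + onA H n)          ≡⟨ cong (λ x → 2 * (H n + x)) (onMultiples-mul a H n q n≡qa) ⟩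
      2 * (H n + H q)              ≡⟨ cong (λ x → 2 * (H x + H q)) n≡qa ⟩
      2 * (H (q * suc a) + H q)    ≤⟨ *-monoʳ-≤ 2 (hits-pair (suc a) A ps cs free q) ⟩
      2 * D q                      ≡⟨ solve 1 (λ x → con 2 :* x := x :+ x) refl (D q) ⟩
      D q + D q                    ≤⟨ +-monoʳ-≤ (D q) (divisorCount-mono A ps q (suc a)) ⟩
      D q + D (q * suc a)          ≡⟨ +-comm (D q) (D (q * suc a)) ⟩
      D (q * suc a) + D q          ≡⟨ cong₂ _+_ (cong D n≡qa) (onMultiples-mul a D n q n≡qa) ⟨
      D n + onA D n                ≡⟨ +-identityʳ (D n + onA D n) ⟨
      D n + onA D n + 0            ∎
    cases (no a∤n) = begin
      2 * (H n + onA H n)          ≡⟨ cong (λ x → 2 * (H n + x)) (onMultiples-non (suc a) H n a∤n) ⟩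
      2 * (H n + 0)                ≡⟨ cong (2 *_) (+-identityʳ (H n)) ⟩
      2 * H n                      ≤⟨ hits-bound A ps cps frees n ⟩
      D n + avoids A n             ≡⟨ cong (λ x → x + avoids A n) (trans (cong (D n +_) (onMultiples-non (suc a) D n a∤n)) (+-identityʳ (D n))) ⟨
      D n + onA D n + avoids A n   ∎

  -- segmentCounts A k = Σ_{T ⊆ A} |S ∩ [k · ∏_{a ∈ T} a]|.
  segmentCounts : List ℕ → ℕ → ℕ
  segmentCounts [] k = count S k
  segmentCounts (a ∷ A) k = segmentCounts A (k * a) + segmentCounts A k

  sumTo-hits : ∀ A → Positive A → ∀ k → sumTo (hits A) (k * ∏ A) ≡ segmentCounts A k
  sumTo-hits [] _ k = trans (cong (sumTo indicator) (*-identityʳ k)) (sumTo-indicator k)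
  sumTo-hits (suc a ∷ A) (s≤s z≤n ∷ ps) k = begin
    sumTo (hits (suc a ∷ A)) (k * (suc a * ∏ A))              ≡⟨ sumTo-withMultiples a (hits A) (hits A) k (∏ A) ⟩
    sumTo (hits A) (k * (suc a * ∏ A)) + sumTo (hits A) (k * ∏ A)
      ≡⟨ cong (λ X → sumTo (hits A) X + sumTo (hits A) (k * ∏ A)) (*-assoc k (suc a) (∏ A)) ⟨
    sumTo (hits A) (k * suc a * ∏ A) + sumTo (hits A) (k * ∏ A) ≡⟨ cong₂ _+_ (sumTo-hits A ps (k * suc a)) (sumTo-hits A ps k) ⟩
    segmentCounts (suc a ∷ A) k                               ∎
    where open ≡-Reasoning

  segmentCounts-bound : ∀ A → Positive A → AllPairs Coprime A → All FreeOfRatio A →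
                        ∀ k → 2 * segmentCounts A k ≤ k * ∏⁺ A + k * ∏⁻ A
  segmentCounts-bound A ps cps frees k = begin
    2 * segmentCounts A k                     ≡⟨ cong (2 *_) (sumTo-hits A ps k) ⟨
    2 * sumTo (hits A) (k * ∏ A)              ≡⟨ sumTo-* 2 (hits A) (k * ∏ A) ⟨
    sumTo (λ n → 2 * hits A n) (k * ∏ A)      ≤⟨ sumTo-mono (hits-bound A ps cps frees) (k * ∏ A) ⟩
    sumTo (λ n → divisorCount A n + avoids A n) (k * ∏ A)
                                              ≡⟨ sumTo-+ (divisorCount A) (avoids A) (k * ∏ A) ⟩
    sumTo (divisorCount A) (k * ∏ A) + sumTo (avoids A) (k * ∏ A)
                                              ≡⟨ cong₂ _+_ (sumTo-divisorCount A ps k) (sumTo-avoids A ps cps k) ⟩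
    k * ∏⁺ A + k * ∏⁻ A                       ∎
    where open ≤-Reasoning

module UpperBound where

  open import Defs
  open import Data.Bool using (Bool)
  open import Data.Nat as ℕ using (ℕ; suc; _≤_; _<_; z≤n; s≤s)
  import Data.Nat.Properties as ℕP
  open import Data.Nat.Coprimality using (Coprime)
  open import Data.Integer as ℤ using (+_; -[1+_])
  open import Data.Rational as ℚ using (1ℚ; ½)
  import Data.Rational.Properties as ℚP
  open import Data.List using (List; []; _∷_)
  open import Data.List.Relation.Unary.All as All using (All; []; _∷_)
  open import Data.List.Relation.Unary.AllPairs using (AllPairs)
  open import Data.Product using (∃; _,_)
  open import Relation.Binary.PropositionalEquality
  open import Data.Rational.Solver using (module +-*-Solver)
  open +-*-Solver using (solve; _:+_; _:*_; :-_; _:-_; _:=_; con)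
  open Embedding
  open Products
  open UpperCount using (FreeOfRatio; segmentCounts; segmentCounts-bound)

  prodTerm-∏ : ∀ A → prodTerm A ℚ.* ⟦ ∏⁺ A ⟧ ≡ ⟦ ∏⁻ A ⟧
  prodTerm-∏ [] = ℚP.*-identityˡ ⟦ 1 ⟧
  prodTerm-∏ (a ∷ A) = begin
    (x ℚ.* p) ℚ.* ⟦ suc a ℕ.* ∏⁺ A ⟧        ≡⟨ cong ((x ℚ.* p) ℚ.*_) (⟦⟧-* (suc a) (∏⁺ A)) ⟩
    (x ℚ.* p) ℚ.* (⟦ suc a ⟧ ℚ.* ⟦ ∏⁺ A ⟧)  ≡⟨ solve 4 (λ x p s t → (x :* p) :* (s :* t) := (x :* s) :* (p :* t)) refl x p ⟦ suc a ⟧ ⟦ ∏⁺ A ⟧ ⟩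
    (x ℚ.* ⟦ suc a ⟧) ℚ.* (p ℚ.* ⟦ ∏⁺ A ⟧)  ≡⟨ cong₂ ℚ._*_ (/-*-cancel (+ (a ℕ.∸ 1)) a) (prodTerm-∏ A) ⟩
    ⟦ a ℕ.∸ 1 ⟧ ℚ.* ⟦ ∏⁻ A ⟧                 ≡⟨ ⟦⟧-* (a ℕ.∸ 1) (∏⁻ A) ⟨
    ⟦ ∏⁻ (a ∷ A) ⟧                            ∎
    where
    open ≡-Reasoning
    x = + (a ℕ.∸ 1) ℚ./ suc a
    p = prodTerm A

  rhoFormula-∏ : ∀ A → rhoFormula A ℚ.* ⟦ 2 ℕ.* ∏⁺ A ⟧ ≡ ⟦ ∏⁺ A ℕ.+ ∏⁻ A ⟧
  rhoFormula-∏ A = begin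
    ½ ℚ.* (1ℚ ℚ.+ p) ℚ.* ⟦ 2 ℕ.* ∏⁺ A ⟧      ≡⟨ cong (½ ℚ.* (1ℚ ℚ.+ p) ℚ.*_) (⟦⟧-* 2 (∏⁺ A)) ⟩
    ½ ℚ.* (1ℚ ℚ.+ p) ℚ.* (⟦ 2 ⟧ ℚ.* P)       ≡⟨ solve 4 (λ h p t P → h :* (con 1ℚ :+ p) :* (t :* P) := (h :* t) :* (P :+ p :* P)) refl ½ p ⟦ 2 ⟧ P ⟩
    (½ ℚ.* ⟦ 2 ⟧) ℚ.* (P ℚ.+ p ℚ.* P)        ≡⟨ cong₂ (λ u v → u ℚ.* (P ℚ.+ v)) (/-*-cancel (+ 1) 1) (prodTerm-∏ A) ⟩
    1ℚ ℚ.* (P ℚ.+ ⟦ ∏⁻ A ⟧)                  ≡⟨ ℚP.*-identityˡ _ ⟩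
    P ℚ.+ ⟦ ∏⁻ A ⟧                           ≡⟨ ⟦⟧-+ (∏⁺ A) (∏⁻ A) ⟨
    ⟦ ∏⁺ A ℕ.+ ∏⁻ A ⟧                        ∎
    where
    open ≡-Reasoning
    p = prodTerm A
    P = ⟦ ∏⁺ A ⟧

  quotientFree⇒freeOfRatio : ∀ A S → QuotientFree A S → All (FreeOfRatio S) A
  quotientFree⇒freeOfRatio A S qf = All.tabulate (λ {a} a∈A m Sma Sm → qf (m ℕ.* a) m Sma Sm a a∈A (ℕP.*-comm m a))

  segmentCounts-dense : ∀ S L N₀ → (∀ j → N₀ < j → L ℚ.* ⟦ j ⟧ ℚ.≤ ⟦ count S j ⟧) →
                        ∀ A → Positive A → ∀ k → N₀ < k → L ℚ.* ⟦ k ℕ.* ∏⁺ A ⟧ ℚ.≤ ⟦ segmentCounts S A k ⟧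
  segmentCounts-dense S L N₀ dense [] _ k k> = subst (λ u → L ℚ.* ⟦ u ⟧ ℚ.≤ ⟦ count S k ⟧) (sym (ℕP.*-identityʳ k)) (dense k k>)
  segmentCounts-dense S L N₀ dense (suc a ∷ A) (s≤s z≤n ∷ ps) k k> = begin
    L ℚ.* ⟦ k ℕ.* (suc (suc a) ℕ.* ∏⁺ A) ⟧                    ≡⟨ cong (λ z → L ℚ.* ⟦ z ⟧) split ⟩
    L ℚ.* ⟦ k ℕ.* suc a ℕ.* ∏⁺ A ℕ.+ k ℕ.* ∏⁺ A ⟧             ≡⟨ cong (L ℚ.*_) (⟦⟧-+ (k ℕ.* suc a ℕ.* ∏⁺ A) (k ℕ.* ∏⁺ A)) ⟩
    L ℚ.* (⟦ k ℕ.* suc a ℕ.* ∏⁺ A ⟧ ℚ.+ ⟦ k ℕ.* ∏⁺ A ⟧)       ≡⟨ ℚP.*-distribˡ-+ L _ _ ⟩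
    L ℚ.* ⟦ k ℕ.* suc a ℕ.* ∏⁺ A ⟧ ℚ.+ L ℚ.* ⟦ k ℕ.* ∏⁺ A ⟧
      ≤⟨ ℚP.+-mono-≤ (segmentCounts-dense S L N₀ dense A ps (k ℕ.* suc a) (ℕP.≤-trans k> (ℕP.m≤m*n k (suc a)))) (segmentCounts-dense S L N₀ dense A ps k k>) ⟩
    ⟦ segmentCounts S A (k ℕ.* suc a) ⟧ ℚ.+ ⟦ segmentCounts S A k ⟧ ≡⟨ ⟦⟧-+ (segmentCounts S A (k ℕ.* suc a)) (segmentCounts S A k) ⟨
    ⟦ segmentCounts S (suc a ∷ A) k ⟧                         ∎
    where
    open ℚP.≤-Reasoning
    split : k ℕ.* (suc (suc a) ℕ.* ∏⁺ A) ≡ k ℕ.* suc a ℕ.* ∏⁺ A ℕ.+ k ℕ.* ∏⁺ A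
    split = ℕS.solve 3 (λ k a P → k ℕS.:* ((ℕS.con 1 ℕS.:+ a) ℕS.:* P) ℕS.:= k ℕS.:* a ℕS.:* P ℕS.:+ k ℕS.:* P) refl k (suc a) (∏⁺ A)
      where import Data.Nat.Solver as NatSolver
            module ℕS = NatSolver.+-*-Solver

  ratio-bound : ∀ ρ L P W G k → ρ ℚ.* ⟦ 2 ℕ.* P ⟧ ≡ ⟦ W ⟧ → 0 < k ℕ.* P →
                L ℚ.* ⟦ k ℕ.* P ⟧ ℚ.≤ ⟦ G ⟧ → 2 ℕ.* G ≤ k ℕ.* W → L ℚ.≤ ρ
  ratio-bound ρ L P W G k ρ≡ kP>0 LkP≤G 2G≤kW = ℚP.*-cancelˡ-≤-pos T {{T-pos}} (begin
    T ℚ.* L                                 ≡⟨ cong (ℚ._* L) (⟦⟧-* 2 (k ℕ.* P)) ⟩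
    ⟦ 2 ⟧ ℚ.* ⟦ k ℕ.* P ⟧ ℚ.* L             ≡⟨ ℚP.*-assoc ⟦ 2 ⟧ ⟦ k ℕ.* P ⟧ L ⟩
    ⟦ 2 ⟧ ℚ.* (⟦ k ℕ.* P ⟧ ℚ.* L)           ≡⟨ cong (⟦ 2 ⟧ ℚ.*_) (ℚP.*-comm ⟦ k ℕ.* P ⟧ L) ⟩
    ⟦ 2 ⟧ ℚ.* (L ℚ.* ⟦ k ℕ.* P ⟧)           ≤⟨ ℚP.*-monoˡ-≤-nonNeg ⟦ 2 ⟧ {{⟦⟧-nonNeg 2}} LkP≤G ⟩
    ⟦ 2 ⟧ ℚ.* ⟦ G ⟧                         ≡⟨ ⟦⟧-* 2 G ⟨
    ⟦ 2 ℕ.* G ⟧                             ≤⟨ ⟦⟧-mono-≤ 2G≤kW ⟩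
    ⟦ k ℕ.* W ⟧                             ≡⟨ ⟦⟧-* k W ⟩
    ⟦ k ⟧ ℚ.* ⟦ W ⟧                         ≡⟨ cong (⟦ k ⟧ ℚ.*_) (trans (sym ρ≡) (cong (ρ ℚ.*_) (⟦⟧-* 2 P))) ⟩
    ⟦ k ⟧ ℚ.* (ρ ℚ.* (⟦ 2 ⟧ ℚ.* ⟦ P ⟧))     ≡⟨ solve 4 (λ k ρ t P → k :* (ρ :* (t :* P)) := t :* (k :* P) :* ρ) refl ⟦ k ⟧ ρ ⟦ 2 ⟧ ⟦ P ⟧ ⟩
    ⟦ 2 ⟧ ℚ.* (⟦ k ⟧ ℚ.* ⟦ P ⟧) ℚ.* ρ       ≡⟨ cong (λ z → ⟦ 2 ⟧ ℚ.* z ℚ.* ρ) (⟦⟧-* k P) ⟨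
    ⟦ 2 ⟧ ℚ.* ⟦ k ℕ.* P ⟧ ℚ.* ρ             ≡⟨ cong (ℚ._* ρ) (⟦⟧-* 2 (k ℕ.* P)) ⟨
    T ℚ.* ρ                                 ∎)
    where
    open ℚP.≤-Reasoning
    T = ⟦ 2 ℕ.* (k ℕ.* P) ⟧
    T-pos : ℚ.Positive T
    T-pos = ⟦⟧-pos (ℕP.*-monoʳ-< 2 kP>0)

  close⇒≥ : ∀ x y ε → ℚ.∣ x ℚ.- y ∣ ℚ.< ε → y ℚ.- ε ℚ.≤ x
  close⇒≥ x y ε close = ℚP.<⇒≤ (subst₂ ℚ._<_ (rearrange₁ x y ε) (rearrange₂ x ε) (ℚP.+-monoˡ-< (x ℚ.- ε) y-x<ε))
    where
    y-x<ε : y ℚ.- x ℚ.< ε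
    y-x<ε = begin-strict
      y ℚ.- x                  ≤⟨ p≤∣p∣ (y ℚ.- x) ⟩
      ℚ.∣ y ℚ.- x ∣            ≡⟨ cong ℚ.∣_∣ (solve 2 (λ x y → y :- x := :- (x :- y)) refl x y) ⟩
      ℚ.∣ ℚ.- (x ℚ.- y) ∣      ≡⟨ ℚP.∣-p∣≡∣p∣ (x ℚ.- y) ⟩
      ℚ.∣ x ℚ.- y ∣            <⟨ close ⟩
      ε                        ∎
      where
      open ℚP.≤-Reasoning
      p≤∣p∣ : ∀ p → p ℚ.≤ ℚ.∣ p ∣
      p≤∣p∣ (ℚ.mkℚ (+ _) _ _) = ℚP.≤-refl
      p≤∣p∣ (ℚ.mkℚ -[1+ _ ] _ _) = ℚ.*≤* ℤ.-≤+
    rearrange₁ : ∀ x y ε → y ℚ.- x ℚ.+ (x ℚ.- ε) ≡ y ℚ.- ε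
    rearrange₁ = solve 3 (λ x y e → y :- x :+ (x :- e) := y :- e) refl
    rearrange₂ : ∀ x ε → ε ℚ.+ (x ℚ.- ε) ≡ x
    rearrange₂ = solve 2 (λ x e → e :+ (x :- e) := x) refl

  upper : (A : List ℕ) → All (1 ℕ.<_) A → AllPairs Coprime A →
          (S : ℕ → Bool) → QuotientFree A S → HasDensity S →
          ∀ ε → ℚ.Positive ε → ∃ λ N → ∀ n → N ≤ n → ratio S n ℚ.≤ rhoFormula A ℚ.+ ε
  upper A 1<A cop S qf hasDensity ε ε>0 with hasDensity ε ε>0
  ... | N₀ , cauchy = N₀ , bound
    where
    k = suc N₀
    bound : ∀ n → N₀ ≤ n → ratio S n ℚ.≤ rhoFormula A ℚ.+ ε
    bound n n≥ = subst (ℚ._≤ rhoFormula A ℚ.+ ε) (solve 2 (λ r e → r :- e :+ e := r) refl (ratio S n) ε) (ℚP.+-monoˡ-≤ ε L≤ρ)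
      where
      L = ratio S n ℚ.- ε
      dense : ∀ j → N₀ < j → L ℚ.* ⟦ j ⟧ ℚ.≤ ⟦ count S j ⟧
      dense (suc j) (s≤s j≥) = ℚP.≤-trans
        (ℚP.*-monoʳ-≤-nonNeg ⟦ suc j ⟧ {{⟦⟧-nonNeg (suc j)}} (close⇒≥ (ratio S j) (ratio S n) ε (cauchy j n j≥ n≥)))
        (ℚP.≤-reflexive (/-*-cancel (+ count S (suc j)) j))
      counting : 2 ℕ.* segmentCounts S A k ≤ k ℕ.* (∏⁺ A ℕ.+ ∏⁻ A)
      counting = ℕP.≤-trans (segmentCounts-bound S A (>1⇒Positive 1<A) cop (quotientFree⇒freeOfRatio A S qf) k)
                            (ℕP.≤-reflexive (sym (ℕP.*-distribˡ-+ k (∏⁺ A) (∏⁻ A))))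
      L≤ρ : L ℚ.≤ rhoFormula A
      L≤ρ = ratio-bound (rhoFormula A) L (∏⁺ A) (∏⁺ A ℕ.+ ∏⁻ A) (segmentCounts S A k) k (rhoFormula-∏ A)
              (ℕP.*-mono-< {0} {k} {0} {∏⁺ A} (s≤s z≤n) (∏⁺-pos A))
              (segmentCounts-dense S L N₀ dense A (>1⇒Positive 1<A) k ℕP.≤-refl) counting

-- alternate a f x y n: write n = aᵛ·m with a ∤ m; the value is x m if v < f is even,
-- y m if v < f is odd, and 0 if v ≥ f.  (The fuel f also makes the recursion structural.)
module Alternating where

  open import Data.Nat as ℕ using (ℕ; zero; suc; _+_; _*_; _≤_; z≤n)
  open import Data.Nat.Properties
  open import Data.Nat.Divisibility using (_∣_; _∣?_; quotient; divides; ∣m⇒∣m*n; n∣m*n)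
  open import Data.Nat.Coprimality using (Coprime)
  import Data.Nat.Coprimality as Coprimality
  open import Relation.Nullary using (Dec; yes; no; contradiction)
  open import Relation.Binary.PropositionalEquality
  open import Data.Empty using (⊥-elim)
  open import Data.Nat.Solver using (module +-*-Solver)
  open +-*-Solver
  open Sums

  alternateᵈ : ∀ {a n} → (ℕ → ℕ) → ℕ → Dec (a ∣ n) → ℕ
  alternateᵈ g v (yes a∣n) = g (quotient a∣n)
  alternateᵈ g v (no _) = v

  alternate : ℕ → ℕ → (ℕ → ℕ) → (ℕ → ℕ) → ℕ → ℕ
  alternate a zero x y n = 0
  alternate a (suc f) x y n = alternateᵈ (alternate a f y x) (x n) (a ∣? n)

  offMultiplesᵈ : ∀ {a n} → ℕ → Dec (a ∣ n) → ℕ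
  offMultiplesᵈ v (yes _) = 0
  offMultiplesᵈ v (no _) = v

  offMultiples : ℕ → (ℕ → ℕ) → ℕ → ℕ
  offMultiples a x n = offMultiplesᵈ (x n) (a ∣? n)

  alternate-split : ∀ a f x y n → alternate a (suc f) x y n ≡ offMultiples a x n + onMultiples a (alternate a f y x) n
  alternate-split a f x y n with a ∣? n
  ... | yes _ = refl
  ... | no _ = sym (+-identityʳ (x n))

  invariant-split : ∀ a x → (∀ m → x (m * suc a) ≡ x m) → ∀ n → x n ≡ offMultiples (suc a) x n + onMultiples (suc a) x n
  invariant-split a x invariant n with suc a ∣? n
  ... | yes (divides q n≡qa) = trans (cong x n≡qa) (invariant q)
  ... | no _ = sym (+-identityʳ (x n))

  alternate-coprime : ∀ (R : ℕ → ℕ → Set) → R 0 0 → ∀ c b → Coprime (suc b) c →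
                      ∀ f X Y X′ Y′ → (∀ m → R (X (m * c)) (X′ m)) → (∀ m → R (Y (m * c)) (Y′ m)) →
                      ∀ n → R (alternate (suc b) f X Y (n * c)) (alternate (suc b) f X′ Y′ n)
  alternate-coprime R R00 c b b⊥c zero X Y X′ Y′ RX RY n = R00
  alternate-coprime R R00 c b b⊥c (suc f) X Y X′ Y′ RX RY n = cases (suc b ∣? (n * c)) (suc b ∣? n)
    where
    cases : (d : Dec (suc b ∣ n * c)) (d′ : Dec (suc b ∣ n)) →
            R (alternateᵈ (alternate (suc b) f Y X) (X (n * c)) d) (alternateᵈ (alternate (suc b) f Y′ X′) (X′ n) d′)
    cases (yes (divides q nc≡qb)) (yes (divides q′ n≡q′b)) =
      subst (λ z → R (alternate (suc b) f Y X z) (alternate (suc b) f Y′ X′ q′)) (sym q≡q′c)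
        (alternate-coprime R R00 c b b⊥c f Y X Y′ X′ RY RX q′)
      where
      q≡q′c : q ≡ q′ * c
      q≡q′c = *-cancelʳ-≡ q (q′ * c) (suc b) (trans (sym nc≡qb) (trans (cong (_* c) n≡q′b)
                (solve 3 (λ q b c → q :* b :* c := q :* c :* b) refl q′ (suc b) c)))
    cases (no _) (no _) = RX n
    cases (yes b∣nc) (no b∤n) = ⊥-elim (coprime-∤-* n (Coprimality.sym b⊥c) b∤n b∣nc)
    cases (no b∤nc) (yes b∣n) = ⊥-elim (b∤nc (∣m⇒∣m*n c b∣n))

  -- More fuel can only turn 0 into a value.
  alternate-fuel-mono : ∀ a f x y n → alternate a f x y n ≤ alternate a (suc f) x y n
  alternate-fuel-mono a zero x y n = z≤n
  alternate-fuel-mono a (suc f) x y n with a ∣? n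
  ... | yes a∣n = alternate-fuel-mono a f y x (quotient a∣n)
  ... | no _ = ≤-refl

  -- Multiplying by a swaps the roles of x and y.
  alternate-flip : ∀ a f x y n → alternate (suc a) f x y (n * suc a) ≤ alternate (suc a) f y x n
  alternate-flip a zero x y n = z≤n
  alternate-flip a (suc f) x y n = ≤-trans (≤-reflexive on-multiple) (alternate-fuel-mono (suc a) f y x n)
    where
    on-multiple : alternate (suc a) (suc f) x y (n * suc a) ≡ alternate (suc a) f y x n
    on-multiple with suc a ∣? (n * suc a)
    ... | yes (divides q na≡qa) = cong (alternate (suc a) f y x) (*-cancelʳ-≡ q n (suc a) (sym na≡qa))
    ... | no a∤na = contradiction (n∣m*n n) a∤na

  alternate-disjoint : ∀ a f x y → (∀ m → x m + y m ≤ 1) → ∀ n → alternate a f x y n + alternate a f y x n ≤ 1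
  alternate-disjoint a zero x y disjoint n = z≤n
  alternate-disjoint a (suc f) x y disjoint n with a ∣? n
  ... | yes a∣n = alternate-disjoint a f y x (λ m → subst (_≤ 1) (+-comm (x m) (y m)) (disjoint m)) (quotient a∣n)
  ... | no _ = disjoint n

-- Sums of alternate over full periods.  evenCount a f and oddCount a f count the
-- n ≤ a^f whose a-adic valuation is < f and even, resp. odd.
module AlternatingSums where

  open import Data.Nat as ℕ using (ℕ; zero; suc; _+_; _*_; _∸_; _^_)
  open import Data.Nat.Properties
  open import Data.Product using (_×_; _,_; proj₁; proj₂)
  open import Relation.Binary.PropositionalEquality
  open import Data.Nat.Solver using (module +-*-Solver)
  open +-*-Solver
  open Sums
  open Alternating

  Invariant : ℕ → (ℕ → ℕ) → Set
  Invariant c x = ∀ m → x (m * c) ≡ x m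

  PeriodSum : (ℕ → ℕ) → ℕ → ℕ → Set
  PeriodSum x M e = ∀ k → sumTo x (k * M) ≡ k * e

  evenCount oddCount : ℕ → ℕ → ℕ
  evenCount a zero = 0
  evenCount a (suc f) = (a ∸ 1) * a ^ f + oddCount a f
  oddCount a zero = 0
  oddCount a (suc f) = evenCount a f

  sumTo-offMultiples : ∀ a x → Invariant (suc a) x → ∀ Z →
                       sumTo (offMultiples (suc a) x) (suc a * Z) + sumTo x Z ≡ sumTo x (suc a * Z)
  sumTo-offMultiples a x invariant Z = begin
    sumTo (offMultiples (suc a) x) (suc a * Z) + sumTo x Z
      ≡⟨ cong (sumTo (offMultiples (suc a) x) (suc a * Z) +_) (sumTo-onMultiples a x Z) ⟨
    sumTo (offMultiples (suc a) x) (suc a * Z) + sumTo (onMultiples (suc a) x) (suc a * Z)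
      ≡⟨ sumTo-+ (offMultiples (suc a) x) (onMultiples (suc a) x) (suc a * Z) ⟨
    sumTo (λ n → offMultiples (suc a) x n + onMultiples (suc a) x n) (suc a * Z)
      ≡⟨ sumTo-cong (invariant-split a x invariant) (suc a * Z) ⟨
    sumTo x (suc a * Z) ∎
    where open ≡-Reasoning

  alternate-periodSum : ∀ a M f x y ex ey → Invariant (suc a) x → Invariant (suc a) y →
                        PeriodSum x M ex → PeriodSum y M ey →
                        PeriodSum (alternate (suc a) f x y) (suc a ^ f * M) (evenCount (suc a) f * ex + oddCount (suc a) f * ey)
  alternate-periodSum a M zero x y ex ey _ _ _ _ k = trans (sumTo-0 (k * (1 * M))) (sym (*-zeroʳ k))
  alternate-periodSum a M (suc f) x y ex ey x-inv y-inv x-sum y-sum k = +-cancelʳ-≡ (k * P * ex) _ _ (begin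
    sumTo (alternate A′ (suc f) x y) (k * (A′ ^ suc f * M)) + k * P * ex
      ≡⟨ cong (λ X → sumTo (alternate A′ (suc f) x y) X + k * P * ex) (solve 4 (λ k a P M → k :* (a :* P :* M) := a :* (k :* (P :* M))) refl k A′ P M) ⟩
    sumTo (alternate A′ (suc f) x y) (A′ * Z) + k * P * ex
      ≡⟨ cong (_+ k * P * ex) (sumTo-cong (alternate-split A′ f x y) (A′ * Z)) ⟩
    sumTo (λ n → offMultiples A′ x n + onMultiples A′ (alternate A′ f y x) n) (A′ * Z) + k * P * ex
      ≡⟨ cong (_+ k * P * ex) (sumTo-+ (offMultiples A′ x) (onMultiples A′ (alternate A′ f y x)) (A′ * Z)) ⟩
    (Off + sumTo (onMultiples A′ (alternate A′ f y x)) (A′ * Z)) + k * P * ex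
      ≡⟨ cong (λ s → (Off + s) + k * P * ex) (trans (sumTo-onMultiples a (alternate A′ f y x) Z) (ih k)) ⟩
    (Off + k * (ev * ey + od * ex)) + k * P * ex
      ≡⟨ solve 3 (λ s u v → (s :+ u) :+ v := (s :+ v) :+ u) refl Off (k * (ev * ey + od * ex)) (k * P * ex) ⟩
    (Off + k * P * ex) + k * (ev * ey + od * ex)
      ≡⟨ cong (_+ k * (ev * ey + od * ex)) off-sum ⟩
    k * A′ * P * ex + k * (ev * ey + od * ex)
      ≡⟨ solve 7 (λ k a P ex ey e o → k :* (con 1 :+ a) :* P :* ex :+ k :* (e :* ey :+ o :* ex) :=
                  k :* ((a :* P :+ o) :* ex :+ e :* ey) :+ k :* P :* ex) refl k a P ex ey ev od ⟩
    k * (evenCount A′ (suc f) * ex + oddCount A′ (suc f) * ey) + k * P * ex ∎)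
    where
    open ≡-Reasoning
    A′ = suc a
    P = A′ ^ f
    Z = k * (P * M)
    ev = evenCount A′ f
    od = oddCount A′ f
    ih : PeriodSum (alternate A′ f y x) (P * M) (ev * ey + od * ex)
    ih = alternate-periodSum a M f y x ey ex y-inv x-inv y-sum x-sum
    Off = sumTo (offMultiples A′ x) (A′ * Z)
    off-sum : Off + k * P * ex ≡ k * A′ * P * ex
    off-sum = begin
      Off + k * P * ex              ≡⟨ cong (Off +_) (trans (sym (x-sum (k * P))) (cong (sumTo x) (*-assoc k P M))) ⟩
      Off + sumTo x Z               ≡⟨ sumTo-offMultiples a x x-inv Z ⟩
      sumTo x (A′ * Z)              ≡⟨ cong (sumTo x) (solve 4 (λ k a P M → a :* (k :* (P :* M)) := k :* a :* P :* M) refl k A′ P M) ⟩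
      sumTo x (k * A′ * P * M)      ≡⟨ x-sum (k * A′ * P) ⟩
      k * A′ * P * ex               ∎

  twice : ℕ → ℕ
  twice zero = 0
  twice (suc t) = suc (suc (twice t))

  evenCount-oddCount-twice : ∀ a t → (evenCount (suc a) (twice t) ≡ suc a * oddCount (suc a) (twice t))
                                   × (suc (suc a) * oddCount (suc a) (twice t) + 1 ≡ suc a ^ twice t)
  evenCount-oddCount-twice a zero = sym (*-zeroʳ a) , cong (_+ 1) (*-zeroʳ a)
  evenCount-oddCount-twice a (suc t) = even≡ , odd≡
    where
    A′ = suc a
    P = A′ ^ twice t
    ev = evenCount A′ (twice t)
    od = oddCount A′ (twice t)
    ih = evenCount-oddCount-twice a t
    even≡ : a * (A′ * P) + ev ≡ A′ * (a * P + od)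
    even≡ = trans (cong (a * (A′ * P) +_) (proj₁ ih))
                  (solve 3 (λ a P o → a :* ((con 1 :+ a) :* P) :+ (con 1 :+ a) :* o := (con 1 :+ a) :* (a :* P :+ o)) refl a P od)
    odd≡ : suc A′ * (a * P + od) + 1 ≡ A′ * (A′ * P)
    odd≡ = begin
      suc A′ * (a * P + od) + 1     ≡⟨ solve 3 (λ a P o → (con 2 :+ a) :* (a :* P :+ o) :+ con 1 := (con 2 :+ a) :* a :* P :+ ((con 2 :+ a) :* o :+ con 1)) refl a P od ⟩
      suc A′ * a * P + (suc A′ * od + 1) ≡⟨ cong (suc A′ * a * P +_) (proj₂ ih) ⟩
      suc A′ * a * P + P            ≡⟨ solve 2 (λ a P → (con 2 :+ a) :* a :* P :+ P := (con 1 :+ a) :* ((con 1 :+ a) :* P)) refl a P ⟩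
      A′ * (A′ * P)                 ∎
      where open ≡-Reasoning

-- Two identities behind the density of S_K, in pure arithmetic: one step (adding a + 1
-- to A, with evenCount = (a+1)·g and oddCount = g) of the recursions for the masses
-- e (even) and o (odd) preserves  2·P⁺·e = R·(P⁺ + P⁻)  and  2·P⁺·o + R·P⁻ = R·P⁺,
-- where P⁺ = ∏(a+1), P⁻ = ∏(a-1) and R is the number of survivors per period.
module MassArithmetic where

  open import Data.Nat as ℕ using (suc; _+_; _*_)
  open import Data.Nat.Properties using (+-cancelʳ-≡; +-assoc)
  open import Relation.Binary.PropositionalEquality
  open import Data.Nat.Solver using (module +-*-Solver)
  open +-*-Solver

  evenMass-step : ∀ a g P⁺ P⁻ e o R → 2 * P⁺ * e ≡ R * (P⁺ + P⁻) → 2 * P⁺ * o + R * P⁻ ≡ R * P⁺ →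
                  2 * (suc (suc a) * P⁺) * (suc a * g * e + g * o) ≡ (suc a * g + g) * R * (suc (suc a) * P⁺ + a * P⁻)
  evenMass-step a g P⁺ P⁻ e o R even odd = begin
    2 * (suc (suc a) * P⁺) * (suc a * g * e + g * o)
      ≡⟨ solve 5 (λ a P g e o → con 2 :* ((con 2 :+ a) :* P) :* ((con 1 :+ a) :* g :* e :+ g :* o)
                               := (con 2 :+ a) :* g :* ((con 1 :+ a) :* (con 2 :* P :* e) :+ con 2 :* P :* o)) refl a P⁺ g e o ⟩
    suc (suc a) * g * (suc a * (2 * P⁺ * e) + 2 * P⁺ * o)    ≡⟨ cong (suc (suc a) * g *_) combined ⟩
    suc (suc a) * g * (R * (suc (suc a) * P⁺ + a * P⁻))
      ≡⟨ solve 4 (λ a g R X → (con 2 :+ a) :* g :* (R :* X) := ((con 1 :+ a) :* g :+ g) :* R :* X) refl a g R (suc (suc a) * P⁺ + a * P⁻) ⟩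
    (suc a * g + g) * R * (suc (suc a) * P⁺ + a * P⁻)        ∎
    where
    open ≡-Reasoning
    combined : suc a * (2 * P⁺ * e) + 2 * P⁺ * o ≡ R * (suc (suc a) * P⁺ + a * P⁻)
    combined = +-cancelʳ-≡ (R * P⁻) _ _ (begin
      suc a * (2 * P⁺ * e) + 2 * P⁺ * o + R * P⁻         ≡⟨ +-assoc (suc a * (2 * P⁺ * e)) (2 * P⁺ * o) (R * P⁻) ⟩
      suc a * (2 * P⁺ * e) + (2 * P⁺ * o + R * P⁻)       ≡⟨ cong₂ (λ u v → suc a * u + v) even odd ⟩
      suc a * (R * (P⁺ + P⁻)) + R * P⁺
        ≡⟨ solve 4 (λ a R S M → (con 1 :+ a) :* (R :* (S :+ M)) :+ R :* S := R :* ((con 2 :+ a) :* S :+ a :* M) :+ R :* M) refl a R P⁺ P⁻ ⟩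
      R * (suc (suc a) * P⁺ + a * P⁻) + R * P⁻           ∎)

  oddMass-step : ∀ a g P⁺ P⁻ e o R → 2 * P⁺ * e ≡ R * (P⁺ + P⁻) → 2 * P⁺ * o + R * P⁻ ≡ R * P⁺ →
                 2 * (suc (suc a) * P⁺) * (suc a * g * o + g * e) + (suc a * g + g) * R * (a * P⁻)
                 ≡ (suc a * g + g) * R * (suc (suc a) * P⁺)
  oddMass-step a g P⁺ P⁻ e o R even odd = begin
    2 * (suc (suc a) * P⁺) * (suc a * g * o + g * e) + (suc a * g + g) * R * (a * P⁻)
      ≡⟨ solve 7 (λ a P g e o R M → con 2 :* ((con 2 :+ a) :* P) :* ((con 1 :+ a) :* g :* o :+ g :* e) :+ ((con 1 :+ a) :* g :+ g) :* R :* (a :* M)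
                 := (con 2 :+ a) :* g :* ((con 1 :+ a) :* (con 2 :* P :* o) :+ con 2 :* P :* e :+ R :* (a :* M))) refl a P⁺ g e o R P⁻ ⟩
    suc (suc a) * g * (suc a * (2 * P⁺ * o) + 2 * P⁺ * e + R * (a * P⁻))  ≡⟨ cong (suc (suc a) * g *_) combined ⟩
    suc (suc a) * g * (R * (suc (suc a) * P⁺))
      ≡⟨ solve 4 (λ a g R X → (con 2 :+ a) :* g :* (R :* X) := ((con 1 :+ a) :* g :+ g) :* R :* X) refl a g R (suc (suc a) * P⁺) ⟩
    (suc a * g + g) * R * (suc (suc a) * P⁺)                                ∎
    where
    open ≡-Reasoning
    combined : suc a * (2 * P⁺ * o) + 2 * P⁺ * e + R * (a * P⁻) ≡ R * (suc (suc a) * P⁺)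
    combined = +-cancelʳ-≡ (suc a * (R * P⁻)) _ _ (begin
      suc a * (2 * P⁺ * o) + 2 * P⁺ * e + R * (a * P⁻) + suc a * (R * P⁻)
        ≡⟨ solve 5 (λ a O E R M → (con 1 :+ a) :* O :+ E :+ R :* (a :* M) :+ (con 1 :+ a) :* (R :* M)
                   := (con 1 :+ a) :* (O :+ R :* M) :+ E :+ R :* (a :* M)) refl a (2 * P⁺ * o) (2 * P⁺ * e) R P⁻ ⟩
      suc a * (2 * P⁺ * o + R * P⁻) + 2 * P⁺ * e + R * (a * P⁻)  ≡⟨ cong₂ (λ u v → suc a * u + v + R * (a * P⁻)) odd even ⟩
      suc a * (R * P⁺) + R * (P⁺ + P⁻) + R * (a * P⁻)
        ≡⟨ solve 4 (λ a R S M → (con 1 :+ a) :* (R :* S) :+ R :* (S :+ M) :+ R :* (a :* M) := R :* ((con 2 :+ a) :* S) :+ (con 1 :+ a) :* (R :* M)) refl a R P⁺ P⁻ ⟩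
      R * (suc (suc a) * P⁺) + suc a * (R * P⁻)                  ∎)

-- The parity sets for K = 2t.  ev A n is 1 if every a ∈ A has a-adic valuation < K in n
-- and these valuations have even sum, and 0 otherwise; od A n is the same with odd sum.
-- S_K = {n : ev A n ≡ 1} is the set of the lower-bound construction.
module ParitySets (t : ℕ) where

  open import Data.Nat as ℕ using (ℕ; suc; _+_; _*_; _^_; _≤_; _<_; z≤n; s≤s)
  open import Data.Nat.Properties
  open import Data.Nat.Coprimality using (Coprime)
  import Data.Nat.Coprimality as Coprimality
  open import Data.List using (List; []; _∷_; length)
  open import Data.List.Membership.Propositional using (_∈_)
  open import Data.List.Relation.Unary.Any using (here; there)
  open import Data.List.Relation.Unary.All as All using (All; []; _∷_)
  open import Data.List.Relation.Unary.AllPairs using (AllPairs; []; _∷_)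
  open import Data.Product using (_×_; _,_; proj₁; proj₂)
  open import Function using (_∘_)
  open import Relation.Binary.PropositionalEquality
  open import Data.Nat.Solver using (module +-*-Solver)
  open +-*-Solver
  open Sums
  open Products
  open Alternating
  open AlternatingSums
  open MassArithmetic

  K : ℕ
  K = twice t

  ev od : List ℕ → ℕ → ℕ
  ev [] n = 1
  ev (a ∷ A) = alternate a K (ev A) (od A)
  od [] n = 0
  od (a ∷ A) = alternate a K (od A) (ev A)

  ev+od≤1 : ∀ A n → ev A n + od A n ≤ 1
  ev+od≤1 [] n = ≤-refl
  ev+od≤1 (a ∷ A) n = alternate-disjoint a K (ev A) (od A) (ev+od≤1 A) n

  -- Multiplying by a number coprime to A changes no valuation of an element of A.
  ev-od-invariant : ∀ c A → Positive A → All (λ b → Coprime b c) A → Invariant c (ev A) × Invariant c (od A)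
  ev-od-invariant c [] _ _ = (λ _ → refl) , (λ _ → refl)
  ev-od-invariant c (suc b ∷ A) (s≤s z≤n ∷ ps) (b⊥c ∷ cs) =
    alternate-coprime _≡_ refl c b b⊥c K (ev A) (od A) (ev A) (od A) (proj₁ ih) (proj₂ ih) ,
    alternate-coprime _≡_ refl c b b⊥c K (od A) (ev A) (od A) (ev A) (proj₂ ih) (proj₁ ih)
    where ih = ev-od-invariant c A ps cs

  -- Multiplying by an element of A changes the parity (or leaves the range).
  ev-od-flip : ∀ A → Positive A → AllPairs Coprime A → ∀ {b} → b ∈ A → ∀ n → (ev A (n * b) ≤ od A n) × (od A (n * b) ≤ ev A n)
  ev-od-flip (suc b ∷ A) (s≤s z≤n ∷ ps) cps (here refl) n = alternate-flip b K (ev A) (od A) n , alternate-flip b K (od A) (ev A) n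
  ev-od-flip (suc a ∷ A) (s≤s z≤n ∷ ps) (cs ∷ cps) {b} (there b∈A) n =
    alternate-coprime _≤_ z≤n b a a⊥b K (ev A) (od A) (od A) (ev A) (proj₁ ∘ ih) (proj₂ ∘ ih) n ,
    alternate-coprime _≤_ z≤n b a a⊥b K (od A) (ev A) (ev A) (od A) (proj₂ ∘ ih) (proj₁ ∘ ih) n
    where
    ih = ev-od-flip A ps cps b∈A
    a⊥b = All.lookup cs b∈A

  -- One period is ∏ a^K; evenMass and oddMass are the numbers of n in a period with
  -- ev A n ≡ 1, resp. od A n ≡ 1; survivors = ∏ (a^K - 1) counts those with some parity.
  period evenMass oddMass survivors : List ℕ → ℕ
  period [] = 1
  period (a ∷ A) = a ^ K * period A
  evenMass [] = 1
  evenMass (a ∷ A) = evenCount a K * evenMass A + oddCount a K * oddMass A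
  oddMass [] = 0
  oddMass (a ∷ A) = evenCount a K * oddMass A + oddCount a K * evenMass A
  survivors [] = 1
  survivors (a ∷ A) = (evenCount a K + oddCount a K) * survivors A

  period-pos : ∀ A → Positive A → 0 < period A
  period-pos [] _ = s≤s z≤n
  period-pos (suc a ∷ A) (_ ∷ ps) = *-mono-< {0} {suc a ^ K} {0} {period A} (m^n>0 (suc a) K) (period-pos A ps)

  ev-od-periodSum : ∀ A → Positive A → AllPairs Coprime A →
                    PeriodSum (ev A) (period A) (evenMass A) × PeriodSum (od A) (period A) (oddMass A)
  ev-od-periodSum [] _ _ = (λ k → sumTo-1 (k * 1)) , (λ k → trans (sumTo-0 (k * 1)) (sym (*-zeroʳ k)))
  ev-od-periodSum (suc a ∷ A) (s≤s z≤n ∷ ps) (cs ∷ cps) =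
    alternate-periodSum a (period A) K (ev A) (od A) (evenMass A) (oddMass A) (proj₁ inv) (proj₂ inv) (proj₁ ih) (proj₂ ih) ,
    alternate-periodSum a (period A) K (od A) (ev A) (oddMass A) (evenMass A) (proj₂ inv) (proj₁ inv) (proj₂ ih) (proj₁ ih)
    where
    ih = ev-od-periodSum A ps cps
    inv = ev-od-invariant (suc a) A ps (All.map Coprimality.sym cs)

  evenMass+oddMass : ∀ A → evenMass A + oddMass A ≡ survivors A
  evenMass+oddMass [] = refl
  evenMass+oddMass (a ∷ A) =
    trans (solve 4 (λ α β e o → α :* e :+ β :* o :+ (α :* o :+ β :* e) := (α :+ β) :* (e :+ o)) refl (evenCount a K) (oddCount a K) (evenMass A) (oddMass A))
          (cong ((evenCount a K + oddCount a K) *_) (evenMass+oddMass A))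

  mass-identities : ∀ A → Positive A → (2 * ∏⁺ A * evenMass A ≡ survivors A * (∏⁺ A + ∏⁻ A))
                                     × (2 * ∏⁺ A * oddMass A + survivors A * ∏⁻ A ≡ survivors A * ∏⁺ A)
  mass-identities [] _ = refl , refl
  mass-identities (suc a ∷ A) (s≤s z≤n ∷ ps) =
    subst (λ α → 2 * ∏⁺ (suc a ∷ A) * (α * e + g * o) ≡ (α + g) * R * (∏⁺ (suc a ∷ A) + ∏⁻ (suc a ∷ A))) (sym even≡)
      (evenMass-step a g (∏⁺ A) (∏⁻ A) e o R (proj₁ ih) (proj₂ ih)) ,
    subst (λ α → 2 * ∏⁺ (suc a ∷ A) * (α * o + g * e) + (α + g) * R * ∏⁻ (suc a ∷ A) ≡ (α + g) * R * ∏⁺ (suc a ∷ A)) (sym even≡)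
      (oddMass-step a g (∏⁺ A) (∏⁻ A) e o R (proj₁ ih) (proj₂ ih))
    where
    g = oddCount (suc a) K
    e = evenMass A
    o = oddMass A
    R = survivors A
    ih = mass-identities A ps
    even≡ : evenCount (suc a) K ≡ suc a * g
    even≡ = proj₁ (evenCount-oddCount-twice a t)

  survivors-step : ∀ a → evenCount (suc a) K + oddCount (suc a) K + 1 ≡ suc a ^ K
  survivors-step a = begin
    evenCount (suc a) K + g + 1   ≡⟨ cong (λ α → α + g + 1) (proj₁ (evenCount-oddCount-twice a t)) ⟩
    suc a * g + g + 1             ≡⟨ cong (_+ 1) (solve 2 (λ a g → (con 1 :+ a) :* g :+ g := (con 2 :+ a) :* g) refl a g) ⟩
    suc (suc a) * g + 1           ≡⟨ proj₂ (evenCount-oddCount-twice a t) ⟩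
    suc a ^ K                     ∎
    where
    open ≡-Reasoning
    g = oddCount (suc a) K

  survivors≤period : ∀ A → Positive A → survivors A ≤ period A
  survivors≤period [] _ = ≤-refl
  survivors≤period (suc a ∷ A) (s≤s z≤n ∷ ps) = *-mono-≤ (≤-trans (m≤m+n _ 1) (≤-reflexive (survivors-step a))) (survivors≤period A ps)

  evenMass≤period : ∀ A → Positive A → evenMass A ≤ period A
  evenMass≤period A ps = ≤-trans (m≤m+n (evenMass A) (oddMass A)) (≤-trans (≤-reflexive (evenMass+oddMass A)) (survivors≤period A ps))

  -- Few numbers are lost: survivors/period ≥ 1 - r/2^K, where r = |A|.
  survivors-large : ∀ A → All (1 <_) A → 2 ^ K * period A ≤ 2 ^ K * survivors A + length A * period A
  survivors-large [] _ = m≤m+n _ _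
  survivors-large (suc a ∷ A) (s≤s (s≤s z≤n) ∷ 1<A) = begin
    2 ^ K * (u * P)                       ≡⟨ solve 3 (λ T u P → T :* (u :* P) := u :* (T :* P)) refl (2 ^ K) u P ⟩
    u * (2 ^ K * P)                       ≤⟨ *-monoʳ-≤ u (survivors-large A 1<A) ⟩
    u * (2 ^ K * R + r * P)               ≡⟨ cong (λ z → z * (2 ^ K * R + r * P)) (survivors-step a) ⟨
    (w + 1) * (2 ^ K * R + r * P)
      ≡⟨ solve 5 (λ w T R r P → (w :+ con 1) :* (T :* R :+ r :* P) := T :* (w :* R) :+ T :* R :+ r :* ((w :+ con 1) :* P)) refl w (2 ^ K) R r P ⟩
    2 ^ K * (w * R) + 2 ^ K * R + r * ((w + 1) * P)  ≡⟨ cong (λ z → 2 ^ K * (w * R) + 2 ^ K * R + r * (z * P)) (survivors-step a) ⟩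
    2 ^ K * (w * R) + 2 ^ K * R + r * (u * P)
      ≤⟨ +-monoˡ-≤ (r * (u * P)) (+-monoʳ-≤ (2 ^ K * (w * R)) (*-mono-≤ (^-monoˡ-≤ K (s≤s (s≤s z≤n))) (survivors≤period A (>1⇒Positive 1<A)))) ⟩
    2 ^ K * (w * R) + u * P + r * (u * P) ≡⟨ +-assoc (2 ^ K * (w * R)) (u * P) (r * (u * P)) ⟩
    2 ^ K * (w * R) + suc r * (u * P)     ∎
    where
    open ≤-Reasoning
    u = suc a ^ K
    P = period A
    R = survivors A
    r = length A
    w = evenCount (suc a) K + oddCount (suc a) K

-- A counting function C with C (k·M) = k·e for all k stays within M·M of the line e·X/M;
-- consequently C X / X is Cauchy with rate O(M / X).
module PeriodicCount (C : ℕ → ℕ) (C-step : ∀ X → C X ≤ C (suc X)) (M e : ℕ) (M>0 : 0 < M) (e≤M : e ≤ M)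
                     (C-period : ∀ k → C (k * M) ≡ k * e) where

  open import Data.Nat as ℕ using (ℕ; zero; suc; _+_; _*_; _∸_; _≤_; _<_; z≤n; _/_; _%_)
  open import Data.Nat.Properties
  open import Data.Nat.DivMod using (m≡m%n+[m/n]*n; m%n<n)
  open import Data.Product using (_×_; _,_; ∃)
  open import Relation.Binary.PropositionalEquality
  open import Data.Nat.Solver using (module +-*-Solver)
  open +-*-Solver

  instance
    M≢0 : ℕ.NonZero M
    M≢0 = ℕ.>-nonZero M>0

  C-mono : ∀ {X Y} → X ≤ Y → C X ≤ C Y
  C-mono {X} {Y} X≤Y = subst (λ Z → C X ≤ C Z) (m∸n+n≡m X≤Y) (shifted (Y ∸ X))
    where
    shifted : ∀ d → C X ≤ C (d + X)
    shifted zero = ≤-refl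
    shifted (suc d) = ≤-trans (shifted d) (C-step (d + X))

  between-periods : ∀ X → ∃ λ q → (q * M ≤ X) × (X ≤ suc q * M)
  between-periods X = X / M , subst (X / M * M ≤_) (sym X≡) (m≤n+m (X / M * M) (X % M)) ,
                      subst (_≤ suc (X / M) * M) (sym X≡) (+-monoˡ-≤ (X / M * M) (<⇒≤ (m%n<n X M)))
    where
    X≡ : X ≡ X % M + X / M * M
    X≡ = m≡m%n+[m/n]*n X M

  count-upper : ∀ X → C X * M ≤ e * X + M * M
  count-upper X with between-periods X
  ... | q , qM≤X , X≤q+1M = begin
    C X * M                 ≤⟨ *-monoˡ-≤ M (subst (C X ≤_) (C-period (suc q)) (C-mono X≤q+1M)) ⟩
    suc q * e * M           ≡⟨ solve 3 (λ q e M → (con 1 :+ q) :* e :* M := e :* (q :* M) :+ e :* M) refl q e M ⟩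
    e * (q * M) + e * M     ≤⟨ +-mono-≤ (*-monoʳ-≤ e qM≤X) (*-monoˡ-≤ M e≤M) ⟩
    e * X + M * M           ∎
    where open ≤-Reasoning

  count-lower : ∀ X → e * X ≤ C X * M + M * M
  count-lower X with between-periods X
  ... | q , qM≤X , X≤q+1M = begin
    e * X                   ≤⟨ *-monoʳ-≤ e X≤q+1M ⟩
    e * (suc q * M)         ≡⟨ solve 3 (λ q e M → e :* ((con 1 :+ q) :* M) := (q :* e) :* M :+ e :* M) refl q e M ⟩
    (q * e) * M + e * M     ≤⟨ +-mono-≤ (*-monoˡ-≤ M (subst (_≤ C X) (C-period q) (C-mono qM≤X))) (*-monoˡ-≤ M e≤M) ⟩
    C X * M + M * M         ∎
    where open ≤-Reasoning

  -- For X₁, X₂ > 2·M·m:  C X₁ / X₁ - C X₂ / X₂ < 1/m.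
  count-cauchy : ∀ m X₁ X₂ → 2 * M * m < X₁ → 2 * M * m < X₂ → C X₁ * X₂ * m < C X₂ * X₁ * m + X₁ * X₂
  count-cauchy m X₁ X₂ X₁> X₂> = *-cancelˡ-< M _ _ (begin-strict
    M * (c₁ * X₂ * m)                         ≡⟨ solve 4 (λ M c X m → M :* (c :* X :* m) := (c :* M) :* (X :* m)) refl M c₁ X₂ m ⟩
    (c₁ * M) * (X₂ * m)                       ≤⟨ *-monoˡ-≤ (X₂ * m) (count-upper X₁) ⟩
    (e * X₁ + M * M) * (X₂ * m)
      ≡⟨ solve 5 (λ e X₁ M X₂ m → (e :* X₁ :+ M :* M) :* (X₂ :* m) := (e :* X₂) :* (X₁ :* m) :+ M :* M :* X₂ :* m) refl e X₁ M X₂ m ⟩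
    (e * X₂) * (X₁ * m) + M * M * X₂ * m      ≤⟨ +-monoˡ-≤ (M * M * X₂ * m) (*-monoˡ-≤ (X₁ * m) (count-lower X₂)) ⟩
    (c₂ * M + M * M) * (X₁ * m) + M * M * X₂ * m
      ≡⟨ solve 5 (λ c₂ M X₁ m X₂ → (c₂ :* M :+ M :* M) :* (X₁ :* m) :+ M :* M :* X₂ :* m := M :* (c₂ :* X₁ :* m) :+ M :* (M :* m :* (X₁ :+ X₂))) refl c₂ M X₁ m X₂ ⟩
    M * (c₂ * X₁ * m) + M * (M * m * (X₁ + X₂))  <⟨ +-monoʳ-< (M * (c₂ * X₁ * m)) (*-monoʳ-< M error<) ⟩
    M * (c₂ * X₁ * m) + M * (X₁ * X₂)         ≡⟨ *-distribˡ-+ M (c₂ * X₁ * m) (X₁ * X₂) ⟨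
    M * (c₂ * X₁ * m + X₁ * X₂)               ∎)
    where
    open ≤-Reasoning
    c₁ = C X₁
    c₂ = C X₂
    error< : M * m * (X₁ + X₂) < X₁ * X₂
    error< = *-cancelˡ-< 2 _ _ (begin-strict
      2 * (M * m * (X₁ + X₂))                   ≡⟨ solve 4 (λ M m X₁ X₂ → con 2 :* (M :* m :* (X₁ :+ X₂)) := X₁ :* (con 2 :* M :* m) :+ (con 2 :* M :* m) :* X₂) refl M m X₁ X₂ ⟩
      X₁ * (2 * M * m) + (2 * M * m) * X₂       <⟨ +-mono-<-≤ (*-monoʳ-< X₁ {{ℕ.>-nonZero (≤-<-trans z≤n X₁>)}} X₂>) (*-monoˡ-≤ X₂ (<⇒≤ X₁>)) ⟩
      X₁ * X₂ + X₁ * X₂                         ≡⟨ solve 2 (λ a b → a :* b :+ a :* b := con 2 :* (a :* b)) refl X₁ X₂ ⟩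
      2 * (X₁ * X₂)                             ∎)

-- With ρ = W / 2P and a periodic set of
-- period M and period count e = ρ·R, where R ≥ M·(1 - r/T) and 2rm ≤ T: once X ≥ 2Mm,
-- a count c with e·X ≤ c·M + M·M satisfies c / X ≥ ρ - 1/m.
module LowerArithmetic where

  open import Data.Nat as ℕ using (_+_; _*_; _≤_; _<_)
  open import Data.Nat.Properties
  open import Relation.Binary.PropositionalEquality
  open import Data.Nat.Solver using (module +-*-Solver)
  open +-*-Solver

  density-lower : ∀ W P e R T M r c X m → R * W ≡ 2 * P * e → W ≤ 2 * P →
                  T * M ≤ T * R + r * M → 2 * r * m ≤ T → e * X ≤ c * M + M * M → 2 * M * m ≤ X → 0 < T * M →
                  W * X * m ≤ 2 * P * (c * m + X)
  density-lower W P e R T M r c X m RW≡ W≤ surviving r-small e-count X-large TM>0 =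
    *-cancelˡ-≤ (2 * (T * M)) {{ℕ.>-nonZero (*-monoʳ-< 2 TM>0)}} (begin
    2 * (T * M) * (W * X * m)                     ≡⟨ solve 5 (λ T M W X m → con 2 :* (T :* M) :* (W :* X :* m) := con 2 :* W :* X :* m :* (T :* M)) refl T M W X m ⟩
    2 * W * X * m * (T * M)                       ≤⟨ *-monoʳ-≤ (2 * W * X * m) surviving ⟩
    2 * W * X * m * (T * R + r * M)
      ≡⟨ solve 7 (λ W X m T R r M → con 2 :* W :* X :* m :* (T :* R :+ r :* M) := con 2 :* T :* m :* X :* (R :* W) :+ con 2 :* r :* m :* (W :* (M :* X))) refl W X m T R r M ⟩
    2 * T * m * X * (R * W) + 2 * r * m * (W * (M * X))  ≡⟨ cong (λ z → 2 * T * m * X * z + 2 * r * m * (W * (M * X))) RW≡ ⟩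
    2 * T * m * X * (2 * P * e) + 2 * r * m * (W * (M * X))
      ≡⟨ cong (_+ 2 * r * m * (W * (M * X))) (solve 5 (λ T m X P e → con 2 :* T :* m :* X :* (con 2 :* P :* e) := con 2 :* T :* m :* (con 2 :* P) :* (e :* X)) refl T m X P e) ⟩
    2 * T * m * (2 * P) * (e * X) + 2 * r * m * (W * (M * X))
      ≤⟨ +-mono-≤ (*-monoʳ-≤ (2 * T * m * (2 * P)) e-count) (*-mono-≤ r-small (*-monoˡ-≤ (M * X) W≤)) ⟩
    2 * T * m * (2 * P) * (c * M + M * M) + T * (2 * P * (M * X))
      ≡⟨ solve 6 (λ T m P c M X → con 2 :* T :* m :* (con 2 :* P) :* (c :* M :+ M :* M) :+ T :* (con 2 :* P :* (M :* X))
                 := con 2 :* (T :* M) :* (con 2 :* P :* (c :* m)) :+ T :* M :* (con 2 :* P) :* (con 2 :* M :* m) :+ T :* M :* (con 2 :* P) :* X) refl T m P c M X ⟩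
    2 * (T * M) * (2 * P * (c * m)) + T * M * (2 * P) * (2 * M * m) + T * M * (2 * P) * X
      ≤⟨ +-monoˡ-≤ (T * M * (2 * P) * X) (+-monoʳ-≤ (2 * (T * M) * (2 * P * (c * m))) (*-monoʳ-≤ (T * M * (2 * P)) X-large)) ⟩
    2 * (T * M) * (2 * P * (c * m)) + T * M * (2 * P) * X + T * M * (2 * P) * X
      ≡⟨ solve 6 (λ T M P c m X → con 2 :* (T :* M) :* (con 2 :* P :* (c :* m)) :+ T :* M :* (con 2 :* P) :* X :+ T :* M :* (con 2 :* P) :* X
                 := con 2 :* (T :* M) :* (con 2 :* P :* (c :* m :+ X))) refl T M P c m X ⟩
    2 * (T * M) * (2 * P * (c * m + X))           ∎)
    where open ≤-Reasoning

module RatioBounds where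

  open import Data.Nat as ℕ using (suc; z≤n; s≤s)
  import Data.Nat.Properties as ℕP
  open import Data.Integer using (+_)
  open import Data.Rational as ℚ using (1ℚ; _/_)
  import Data.Rational.Properties as ℚP
  open import Data.Sum using (inj₁; inj₂)
  open import Relation.Binary.PropositionalEquality
  open import Data.Rational.Solver using (module +-*-Solver)
  open +-*-Solver using (solve; _:+_; _:*_; _:-_; _:=_; con)
  open Embedding

  ∣∣-< : ∀ p ε → p ℚ.< ε → ℚ.- p ℚ.< ε → ℚ.∣ p ∣ ℚ.< ε
  ∣∣-< p ε p<ε -p<ε with ℚP.∣p∣≡p∨∣p∣≡-p p
  ... | inj₁ ∣p∣≡p = subst (ℚ._< ε) (sym ∣p∣≡p) p<ε
  ... | inj₂ ∣p∣≡-p = subst (ℚ._< ε) (sym ∣p∣≡-p) -p<ε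

  ratio-gap : ∀ c₁ c₂ x₁ x₂ m ε → 1ℚ ℚ.≤ ⟦ suc m ⟧ ℚ.* ε →
              c₁ ℕ.* suc x₂ ℕ.* suc m ℕ.< c₂ ℕ.* suc x₁ ℕ.* suc m ℕ.+ suc x₁ ℕ.* suc x₂ →
              (+ c₁ / suc x₁) ℚ.- (+ c₂ / suc x₂) ℚ.< ε
  ratio-gap c₁ c₂ x₁ x₂ m ε mε≥1 cross = ℚP.*-cancelʳ-<-nonNeg D {{D-nonNeg}} (begin-strict
    (r₁ ℚ.- r₂) ℚ.* D
      ≡⟨ solve 5 (λ r₁ r₂ X₁ X₂ m → (r₁ :- r₂) :* (X₁ :* X₂ :* m) := (r₁ :* X₁) :* X₂ :* m :- (r₂ :* X₂) :* X₁ :* m) refl r₁ r₂ X₁ X₂ M ⟩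
    (r₁ ℚ.* X₁) ℚ.* X₂ ℚ.* M ℚ.- (r₂ ℚ.* X₂) ℚ.* X₁ ℚ.* M
      ≡⟨ cong₂ (λ u v → u ℚ.* X₂ ℚ.* M ℚ.- v ℚ.* X₁ ℚ.* M) (/-*-cancel (+ c₁) x₁) (/-*-cancel (+ c₂) x₂) ⟩
    ⟦ c₁ ⟧ ℚ.* X₂ ℚ.* M ℚ.- ⟦ c₂ ⟧ ℚ.* X₁ ℚ.* M  <⟨ ℚP.+-monoˡ-< (ℚ.- (⟦ c₂ ⟧ ℚ.* X₁ ℚ.* M)) cross′ ⟩
    ⟦ c₂ ⟧ ℚ.* X₁ ℚ.* M ℚ.+ X₁ ℚ.* X₂ ℚ.- ⟦ c₂ ⟧ ℚ.* X₁ ℚ.* M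
      ≡⟨ solve 2 (λ a b → a :+ b :- a := b :* con 1ℚ) refl (⟦ c₂ ⟧ ℚ.* X₁ ℚ.* M) (X₁ ℚ.* X₂) ⟩
    X₁ ℚ.* X₂ ℚ.* 1ℚ                              ≤⟨ ℚP.*-monoˡ-≤-nonNeg (X₁ ℚ.* X₂) {{X₁X₂-nonNeg}} mε≥1 ⟩
    X₁ ℚ.* X₂ ℚ.* (M ℚ.* ε)                       ≡⟨ solve 4 (λ a b m e → a :* b :* (m :* e) := e :* (a :* b :* m)) refl X₁ X₂ M ε ⟩
    ε ℚ.* D                                       ∎)
    where
    open ℚP.≤-Reasoning
    r₁ = + c₁ / suc x₁
    r₂ = + c₂ / suc x₂
    X₁ = ⟦ suc x₁ ⟧
    X₂ = ⟦ suc x₂ ⟧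
    M = ⟦ suc m ⟧
    D = X₁ ℚ.* X₂ ℚ.* M
    X₁X₂-nonNeg : ℚ.NonNegative (X₁ ℚ.* X₂)
    X₁X₂-nonNeg = subst ℚ.NonNegative (⟦⟧-* (suc x₁) (suc x₂)) (⟦⟧-nonNeg (suc x₁ ℕ.* suc x₂))
    D-nonNeg : ℚ.NonNegative D
    D-nonNeg = subst ℚ.NonNegative (trans (⟦⟧-* (suc x₁ ℕ.* suc x₂) (suc m)) (cong (ℚ._* M) (⟦⟧-* (suc x₁) (suc x₂))))
                 (⟦⟧-nonNeg (suc x₁ ℕ.* suc x₂ ℕ.* suc m))
    cross′ : ⟦ c₁ ⟧ ℚ.* X₂ ℚ.* M ℚ.< ⟦ c₂ ⟧ ℚ.* X₁ ℚ.* M ℚ.+ X₁ ℚ.* X₂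
    cross′ = subst₂ ℚ._<_ (trans (⟦⟧-* (c₁ ℕ.* suc x₂) (suc m)) (cong (ℚ._* M) (⟦⟧-* c₁ (suc x₂))))
               (trans (⟦⟧-+ (c₂ ℕ.* suc x₁ ℕ.* suc m) (suc x₁ ℕ.* suc x₂))
                      (cong₂ ℚ._+_ (trans (⟦⟧-* (c₂ ℕ.* suc x₁) (suc m)) (cong (ℚ._* M) (⟦⟧-* c₂ (suc x₁)))) (⟦⟧-* (suc x₁) (suc x₂))))
               (⟦⟧-mono-< cross)

  ratio-≥ : ∀ W P c x m ε ρ → ρ ℚ.* ⟦ 2 ℕ.* P ⟧ ≡ ⟦ W ⟧ → 0 ℕ.< P → 1ℚ ℚ.≤ ⟦ suc m ⟧ ℚ.* ε →
            W ℕ.* suc x ℕ.* suc m ℕ.≤ 2 ℕ.* P ℕ.* (c ℕ.* suc m ℕ.+ suc x) → ρ ℚ.- ε ℚ.≤ + c / suc x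
  ratio-≥ W P c x m ε ρ ρ≡ P>0 mε≥1 cross = ℚP.*-cancelʳ-≤-pos D {{D-pos}} (begin
    (ρ ℚ.- ε) ℚ.* D
      ≡⟨ solve 5 (λ ρ ε T X m → (ρ :- ε) :* (T :* X :* m) := (ρ :* T) :* X :* m :- T :* X :* (m :* ε)) refl ρ ε T X M ⟩
    (ρ ℚ.* T) ℚ.* X ℚ.* M ℚ.- T ℚ.* X ℚ.* (M ℚ.* ε)
      ≤⟨ ℚP.+-monoʳ-≤ ((ρ ℚ.* T) ℚ.* X ℚ.* M) (ℚP.neg-antimono-≤ (ℚP.*-monoˡ-≤-nonNeg (T ℚ.* X) {{TX-nonNeg}} mε≥1)) ⟩
    (ρ ℚ.* T) ℚ.* X ℚ.* M ℚ.- T ℚ.* X ℚ.* 1ℚ     ≡⟨ cong (λ z → z ℚ.* X ℚ.* M ℚ.- T ℚ.* X ℚ.* 1ℚ) ρ≡ ⟩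
    ⟦ W ⟧ ℚ.* X ℚ.* M ℚ.- T ℚ.* X ℚ.* 1ℚ         ≤⟨ ℚP.+-monoˡ-≤ (ℚ.- (T ℚ.* X ℚ.* 1ℚ)) cross′ ⟩
    T ℚ.* (⟦ c ⟧ ℚ.* M ℚ.+ X) ℚ.- T ℚ.* X ℚ.* 1ℚ ≡⟨ cong (λ z → T ℚ.* (z ℚ.* M ℚ.+ X) ℚ.- T ℚ.* X ℚ.* 1ℚ) (/-*-cancel (+ c) x) ⟨
    T ℚ.* (r ℚ.* X ℚ.* M ℚ.+ X) ℚ.- T ℚ.* X ℚ.* 1ℚ
      ≡⟨ solve 4 (λ T r X m → T :* (r :* X :* m :+ X) :- T :* X :* con 1ℚ := r :* (T :* X :* m)) refl T r X M ⟩
    r ℚ.* D                                       ∎)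
    where
    open ℚP.≤-Reasoning
    r = + c / suc x
    T = ⟦ 2 ℕ.* P ⟧
    X = ⟦ suc x ⟧
    M = ⟦ suc m ⟧
    D = T ℚ.* X ℚ.* M
    TX-nonNeg : ℚ.NonNegative (T ℚ.* X)
    TX-nonNeg = subst ℚ.NonNegative (⟦⟧-* (2 ℕ.* P) (suc x)) (⟦⟧-nonNeg (2 ℕ.* P ℕ.* suc x))
    D-pos : ℚ.Positive D
    D-pos = subst ℚ.Positive (trans (⟦⟧-* (2 ℕ.* P ℕ.* suc x) (suc m)) (cong (ℚ._* M) (⟦⟧-* (2 ℕ.* P) (suc x))))
              (⟦⟧-pos (ℕP.*-mono-< {0} {2 ℕ.* P ℕ.* suc x} {0} {suc m}
                 (ℕP.*-mono-< {0} {2 ℕ.* P} {0} {suc x} (ℕP.*-monoʳ-< 2 P>0) (s≤s z≤n)) (s≤s z≤n)))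
    cross′ : ⟦ W ⟧ ℚ.* X ℚ.* M ℚ.≤ T ℚ.* (⟦ c ⟧ ℚ.* M ℚ.+ X)
    cross′ = subst₂ ℚ._≤_ (trans (⟦⟧-* (W ℕ.* suc x) (suc m)) (cong (ℚ._* M) (⟦⟧-* W (suc x))))
               (trans (⟦⟧-* (2 ℕ.* P) (c ℕ.* suc m ℕ.+ suc x)) (cong (T ℚ.*_) (trans (⟦⟧-+ (c ℕ.* suc m) (suc x)) (cong (ℚ._+ X) (⟦⟧-* c (suc m))))))
               (⟦⟧-mono-≤ cross)

module LowerBound where

  open import Defs
  open import Data.Bool using (Bool; true; false; if_then_else_)
  open import Data.Nat as ℕ using (ℕ; zero; suc; _+_; _*_; _^_; _≤_; _<_; z≤n; s≤s)
  open import Data.Nat.Properties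
  open import Data.Nat.Coprimality using (Coprime)
  open import Data.Rational as ℚ using (1ℚ)
  open import Data.List using (List; length)
  open import Data.List.Relation.Unary.All using (All)
  open import Data.List.Relation.Unary.AllPairs using (AllPairs)
  open import Data.Product using (∃; _×_; _,_; proj₁)
  open import Relation.Binary.PropositionalEquality
  open import Data.Rational.Solver using (module +-*-Solver)
  open +-*-Solver using (solve; _:-_; _:=_; :-_)
  open Embedding
  open Sums
  open Products
  open AlternatingSums using (twice)
  open UpperBound using (rhoFormula-∏)
  open RatioBounds
  open LowerArithmetic

  2t≤2^twice : ∀ t → 2 * t ≤ 2 ^ twice t
  2t≤2^twice zero = z≤n
  2t≤2^twice (suc t) = begin
    2 * suc t                        ≡⟨ *-suc 2 t ⟩
    2 + 2 * t                        ≤⟨ +-mono-≤ (*-monoʳ-≤ 2 (m^n>0 2 (twice t))) (≤-trans (2t≤2^twice t) (m≤n*m (2 ^ twice t) 2)) ⟩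
    2 * 2 ^ twice t + 2 * 2 ^ twice t ≡⟨ cong (2 * 2 ^ twice t +_) (sym (+-identityʳ (2 * 2 ^ twice t))) ⟩
    2 ^ twice (suc t)                ∎
    where open ≤-Reasoning

  isOne : ℕ → Bool
  isOne (suc zero) = true
  isOne _ = false

  isOne-indicator : ∀ {v} → v ≤ 1 → (if isOne v then 1 else 0) ≡ v
  isOne-indicator {zero} _ = refl
  isOne-indicator {suc zero} _ = refl
  isOne-indicator {suc (suc _)} (s≤s ())

  isOne-true : ∀ v → isOne v ≡ true → v ≡ 1
  isOne-true (suc zero) _ = refl
  isOne-true zero ()
  isOne-true (suc (suc _)) ()

  module Construction (A : List ℕ) (1<A : All (1 <_) A) (cop : AllPairs Coprime A) (t : ℕ) where
    open ParitySets t

    A⁺ : Positive A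
    A⁺ = >1⇒Positive 1<A

    S : ℕ → Bool
    S zero = false
    S (suc n) = isOne (ev A (suc n))

    ev≤1 : ∀ n → ev A n ≤ 1
    ev≤1 n = ≤-trans (m≤m+n (ev A n) (od A n)) (ev+od≤1 A n)

    count≡sumTo-ev : ∀ X → count S X ≡ sumTo (ev A) X
    count≡sumTo-ev zero = refl
    count≡sumTo-ev (suc X) = cong₂ _+_ (isOne-indicator (ev≤1 (suc X))) (count≡sumTo-ev X)

    count-period : ∀ k → count S (k * period A) ≡ k * evenMass A
    count-period k = trans (count≡sumTo-ev (k * period A)) (proj₁ (ev-od-periodSum A A⁺ cop) k)

    open PeriodicCount (count S) (λ X → m≤n+m (count S X) _) (period A) (evenMass A)
                       (period-pos A A⁺) (evenMass≤period A A⁺) count-period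

    S⇒ev≡1 : ∀ n → S n ≡ true → ev A n ≡ 1
    S⇒ev≡1 zero ()
    S⇒ev≡1 (suc n) Sn = isOne-true _ Sn

    -- n·a ∈ S would need odd parity at n, excluded by n ∈ S.
    quotientFree : QuotientFree A S
    quotientFree _ zero _ () _ _ _
    quotientFree x (suc y) Sx Sy a a∈A refl = <-irrefl refl (≤-trans (+-mono-≤ ev≥1 od≥1) (ev+od≤1 A (suc y)))
      where
      ev≥1 : 1 ≤ ev A (suc y)
      ev≥1 = ≤-reflexive (sym (S⇒ev≡1 (suc y) Sy))
      ev[ya]≡1 : ev A (suc y * a) ≡ 1
      ev[ya]≡1 = trans (cong (ev A) (*-comm (suc y) a)) (S⇒ev≡1 (a * suc y) Sx)
      od≥1 : 1 ≤ od A (suc y)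
      od≥1 = subst (_≤ od A (suc y)) ev[ya]≡1 (proj₁ (ev-od-flip A A⁺ cop a∈A (suc y)))

    hasDensity : HasDensity S
    hasDensity ε ε>0 with archimedean ε ε>0
    ... | m , mε≥1 = N , λ i j i≥ j≥ → ∣∣-< _ ε (gap i j i≥ j≥) (subst (ℚ._< ε) (antisym-gap i j) (gap j i j≥ i≥))
      where
      N = 2 * period A * suc m
      gap : ∀ i j → N ≤ i → N ≤ j → ratio S i ℚ.- ratio S j ℚ.< ε
      gap i j i≥ j≥ = ratio-gap (count S (suc i)) (count S (suc j)) i j m ε mε≥1 (count-cauchy (suc m) (suc i) (suc j) (s≤s i≥) (s≤s j≥))
      antisym-gap : ∀ i j → ratio S j ℚ.- ratio S i ≡ ℚ.- (ratio S i ℚ.- ratio S j)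
      antisym-gap i j = solve 2 (λ a b → b :- a := :- (a :- b)) refl (ratio S i) (ratio S j)

    ratio-lower : ∀ m ε → 1ℚ ℚ.≤ ⟦ suc m ⟧ ℚ.* ε → 2 * length A * suc m ≤ 2 ^ K →
                  ∀ n → 2 * period A * suc m ≤ n → rhoFormula A ℚ.- ε ℚ.≤ ratio S n
    ratio-lower m ε mε≥1 K-large n n≥ =
      ratio-≥ (∏⁺ A + ∏⁻ A) (∏⁺ A) (count S (suc n)) n m ε (rhoFormula A) (rhoFormula-∏ A) (∏⁺-pos A) mε≥1
        (density-lower (∏⁺ A + ∏⁻ A) (∏⁺ A) (evenMass A) (survivors A) (2 ^ K) (period A) (length A) (count S (suc n)) (suc n) (suc m)
           (sym (proj₁ (mass-identities A A⁺))) W≤2∏⁺ (survivors-large A 1<A) K-large (count-lower (suc n)) (≤-trans n≥ (n≤1+n n))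
           (*-mono-< {0} {2 ^ K} {0} {period A} (m^n>0 2 K) (period-pos A A⁺)))
      where
      W≤2∏⁺ : ∏⁺ A + ∏⁻ A ≤ 2 * ∏⁺ A
      W≤2∏⁺ = ≤-trans (+-monoʳ-≤ (∏⁺ A) (∏⁻≤∏⁺ A)) (≤-reflexive (cong (∏⁺ A +_) (sym (+-identityʳ (∏⁺ A)))))

  lower : (A : List ℕ) → All (1 <_) A → AllPairs Coprime A →
          ∀ ε → ℚ.Positive ε → ∃ λ (S : ℕ → Bool) → PositiveSet S × QuotientFree A S × HasDensity S ×
            ∃ λ N → ∀ n → N ≤ n → rhoFormula A ℚ.- ε ℚ.≤ ratio S n
  lower A 1<A cop ε ε>0 with archimedean ε ε>0
  ... | m , mε≥1 = S , refl , quotientFree , hasDensity , 2 * period A * suc m , ratio-lower m ε mε≥1 K-large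
    where
    t = suc m * length A
    open Construction A 1<A cop t
    open ParitySets t using (K; period)
    K-large : 2 * length A * suc m ≤ 2 ^ K
    K-large = ≤-trans (≤-reflexive (trans (*-assoc 2 (length A) (suc m)) (cong (2 *_) (*-comm (length A) (suc m))))) (2t≤2^twice t)

theorem4 : (A : List ℕ) → AllPairs ℕ._<_ A → All (1 ℕ.<_) A → AllPairs Coprime A →
    ((S : ℕ → Bool) → PositiveSet S → QuotientFree A S → HasDensity S →
      ∀ ε → ℚ.Positive ε → ∃ λ N → ∀ n → N ℕ.≤ n → ratio S n ℚ.≤ rhoFormula A ℚ.+ ε)
    × (∀ ε → ℚ.Positive ε → ∃ λ (S : ℕ → Bool) → PositiveSet S × QuotientFree A S × HasDensity S ×
      ∃ λ N → ∀ n → N ℕ.≤ n → rhoFormula A ℚ.- ε ℚ.≤ ratio S n)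
theorem4 A _ 1<A coprime =
  (λ S _ quotientFree hasDensity → UpperBound.upper A 1<A coprime S quotientFree hasDensity) ,
  LowerBound.lower A 1<A coprime
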